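{- Let $C=\langle a,b\rangle$ be an HFP-code of type Q of length $4n$, and assume that $\pi_a=(1,2,\dots,2n)(2n+1,\dots,4n)$ and $\pi_b=(1,4n)(2,4n-1)\cdots(2n,2n+1)$. If the kernel $K(C)$ has dimension $2$, then the vector $\kappa\in K(C)\setminus\{\mathbf 0,\mathbf 1\}$ with a $0$ in the first coordinate is $\kappa=(v\,\|\,w)$, where $v=(0,1,0,1,\dots,0,1)\in\mathbb{F}^{2n}$ and either $w=v$ or $w=v+\mathbf 1$.
   Context: Let $\mathbb{F}=\mathbb{Z}_2$. $\mathbf 0,\mathbf 1$ denote the all-zero and all-one vectors (of the appropriate length); $(v\,\|\,w)$ denotes concatenation. For a permutation $\pi$ of $\{1,\dots,m\}$ and $v\in\mathbb{F}^m$, $\pi(v)=(v_{\pi^{ -1}(1)},\dots,v_{\pi^{ -1}(m)})$; permutations are in cycle notation. A binary Hadamard matrix of order $4n$ is obtained from a $4n\times4n$ matrix with entries $\pm1$ and $HH^T=4nI$ by replacing $+1$ by $0$ and $-1$ by $1$; the binary Hadamard code it defines is the set of its rows together with their complements. A code $C\subseteq\mathbb{F}^m$ with $\mathbf 0\in C$ is propelinear if to each $x\in C$ a coordinate permutation $\pi_x$ is assigned such that for all $x,y\in C$: $x+\pi_x(y)\in C$ and $\pi_x\pi_y=\pi_{x+\pi_x(y)}$; then $x\cdot y:=x+\pi_x(y)$ makes $(C,\cdot)$ a group with identity $\mathbf 0$. An HFP-code of length $4n$ is a propelinear code that is also a binary Hadamard code of length $4n$, with $\pi_{\mathbf 0}=\pi_{\mathbf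 1}=\mathrm{id}$ and such that for every $a\in C\setminus\{\mathbf 0,\mathbf 1\}$, $\pi_a$ has no fixed coordinate. An HFP-code $C$ of length $4n$ is of type Q, written $C=\langle a,b\rangle$, if there are $a,b\in C$ generating $(C,\cdot)$ with presentation $\langle a,b: a^{4n}=\mathbf 0,\ a^{2n}=b^2,\ b^{ -1}ab=a^{ -1}\rangle$. The kernel is $K(C)=\{z: C+z=C\}$, a linear subspace. -}

module Defs where

open import Data.Bool using (Bool; true; false; not; _xor_; if_then_else_)
open import Data.Nat using (ℕ; zero; suc; _+_; _*_; _∸_; _≡ᵇ_)
open import Data.Integer using (ℤ) renaming (_+_ to _+ℤ_; _*_ to _*ℤ_)
import Data.Integer as ℤ
open import Data.Fin using (Fin; toℕ; _≟_)
open import Data.Vec using (Vec; lookup; tabulate; zipWith; replicate; _++_; map)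
open import Data.Fin.Permutation using (Permutation′; _⟨$⟩ʳ_; _⟨$⟩ˡ_)
open import Data.Product using (Σ; _×_; ∃; _,_)
open import Data.Sum using (_⊎_)
open import Relation.Binary.PropositionalEquality using (_≡_; _≢_)
open import Relation.Nullary using (does)

-- Binary words of length m over F = Z_2 (Bool, with xor as addition).
Word : ℕ → Set
Word m = Vec Bool m

-- The length 4n, written as 2n + 2n so that (v ‖ w) with v,w ∈ F^{2n}
-- is literally the vector concatenation _++_.
len : ℕ → ℕ
len n = 2 * n + 2 * n

𝟎 : ∀ {m} → Word m
𝟎 = replicate _ false

𝟏 : ∀ {m} → Word m
𝟏 = replicate _ true

_⊕_ : ∀ {m} → Word m → Word m → Word m
_⊕_ = zipWith _xor_

act : ∀ {m} → Permutation′ m → Word m → Word m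
act π v = tabulate (λ i → lookup v (π ⟨$⟩ˡ i))

sgn : Bool → ℤ
sgn false = ℤ.+ 1
sgn true  = ℤ.- (ℤ.+ 1)

sumℤ : ∀ {m} → (Fin m → ℤ) → ℤ
sumℤ {zero}  f = ℤ.+ 0
sumℤ {suc m} f = f Fin.zero +ℤ sumℤ (λ i → f (Fin.suc i))
  where import Data.Fin as Fin

IsBinaryHadamard : (m : ℕ) → (Fin m → Word m) → Set
IsBinaryHadamard m H =
  ∀ i j → sumℤ (λ k → sgn (lookup (H i) k) *ℤ sgn (lookup (H j) k))
          ≡ (if does (i ≟ j) then ℤ.+ m else ℤ.+ 0)

IsHadamardCode : (m : ℕ) → (Word m → Set) → Set
IsHadamardCode m C =
  Σ (Fin m → Word m) λ H → IsBinaryHadamard m H ×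
    (∀ x → (C x → ∃ λ i → x ≡ H i ⊎ x ≡ map not (H i))
         × ((∃ λ i → x ≡ H i ⊎ x ≡ map not (H i)) → C x))

_·[_]_ : ∀ {m} → Word m → (Word m → Permutation′ m) → Word m → Word m
x ·[ π ] y = x ⊕ act (π x) y

IsPropelinear : ∀ {m} → (Word m → Set) → (Word m → Permutation′ m) → Set
IsPropelinear C π =
  C 𝟎 ×
  (∀ x y → C x → C y → C (x ·[ π ] y)) ×
  (∀ x y → C x → C y → ∀ i → π x ⟨$⟩ʳ (π y ⟨$⟩ʳ i) ≡ π (x ·[ π ] y) ⟨$⟩ʳ i)

IsHFP : (m : ℕ) → (Word m → Set) → (Word m → Permutation′ m) → Set
IsHFP m C π =
  IsPropelinear C π × IsHadamardCode m C ×
  (∀ i → π 𝟎 ⟨$⟩ʳ i ≡ i) × (∀ i → π 𝟏 ⟨$⟩ʳ i ≡ i) ×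
  (∀ a → C a → a ≢ 𝟎 → a ≢ 𝟏 → ∀ i → π a ⟨$⟩ʳ i ≢ i)

pow : ∀ {m} → (Word m → Permutation′ m) → Word m → ℕ → Word m
pow π x zero    = 𝟎
pow π x (suc k) = x ·[ π ] pow π x k

-- Elements reachable from 𝟎 by right multiplication with a or b.
-- In a finite group the submonoid generated by {a,b} is the subgroup
-- generated by {a,b}.
data Gen {m} (π : Word m → Permutation′ m) (a b : Word m) : Word m → Set where
  gen-0 : Gen π a b 𝟎
  gen-a : ∀ {x} → Gen π a b x → Gen π a b (x ·[ π ] a)
  gen-b : ∀ {x} → Gen π a b x → Gen π a b (x ·[ π ] b)

IsTypeQ : (n : ℕ) → (Word (len n) → Set) → (Word (len n) → Permutation′ (len n))
        → Word (len n) → Word (len n) → Set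
IsTypeQ n C π a b =
  C a × C b ×
  pow π a (4 * n) ≡ 𝟎 ×
  pow π a (2 * n) ≡ pow π b 2 ×
  (Σ (Word (len n)) λ a⁻ → Σ (Word (len n)) λ b⁻ →
     C a⁻ × C b⁻ × a ·[ π ] a⁻ ≡ 𝟎 × b ·[ π ] b⁻ ≡ 𝟎 ×
     (b⁻ ·[ π ] a) ·[ π ] b ≡ a⁻) ×
  (∀ x → C x → Gen π a b x)

Kernel : ∀ {m} → (Word m → Set) → Word m → Set
Kernel C z = ∀ x → (C x → C (x ⊕ z)) × (C (x ⊕ z) → C x)

scal : ∀ {m} → Bool → Word m → Word m
scal c u = map (λ t → if c then t else false) u

KernelDim2 : ∀ {m} → (Word m → Set) → Set
KernelDim2 {m} C =
  Σ (Word m) λ u → Σ (Word m) λ w →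
    u ≢ 𝟎 × w ≢ 𝟎 × u ≢ w ×
    (∀ z → (Kernel C z → ∃ λ c → ∃ λ d → z ≡ scal c u ⊕ scal d w)
         × ((∃ λ c → ∃ λ d → z ≡ scal c u ⊕ scal d w) → Kernel C z))

-- The specific permutations (0-based coordinates)

-- π_a = (1,2,…,2n)(2n+1,…,4n)
cycA : ℕ → ℕ → ℕ
cycA n k = if suc k ≡ᵇ 2 * n then 0
           else if suc k ≡ᵇ 4 * n then 2 * n
           else suc k

revB : ℕ → ℕ → ℕ
revB n k = (4 * n ∸ 1) ∸ k

odd : ℕ → Bool
odd zero          = false
odd (suc zero)    = true
odd (suc (suc k)) = odd k

vAlt : (n : ℕ) → Word (2 * n)
vAlt n = tabulate (λ i → odd (toℕ i))

module Submission where

-- π_a has order 2n, so π fixes all coordinates at a²ⁿ, which is therefore 𝟎 or 𝟏; the group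
-- relations rule out 𝟎. Left multiplication by a shows that K(C) = {𝟎, 𝟏, κ, κ + 𝟏} is invariant
-- under π_a, so π_a κ is κ or κ + 𝟏. In the second case κ alternates along both cycles of π_a, which
-- is the claimed shape. In the first case κ = (0…0 ‖ 1…1), which is impossible: orthogonality to 𝟎
-- and to κ makes every other codeword balanced on each half. For a this means weight n on the lower
-- half, whose parity is a bit of a²ⁿ = 𝟏, so n is odd; for n ≥ 2 the same applies to a² = a + π_a(a),
-- whose lower half has even weight. For n = 1 it makes C closed under adding a, so that a ∈ K(C)
-- and dim K(C) > 2.

open import Defs
open import Algebra.Bundles using (CommutativeRing)
open import Data.Bool using (Bool; true; false; not; _xor_; T)
open import Data.Bool.Properties
  using (xor-assoc; xor-comm; xor-identityʳ; xor-same; xor-annihilates-not; not-involutive; not-distribˡ-xor; ¬-not;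
         xor-∧-commutativeRing)
  renaming (_≟_ to _≟ᴮ_)
open import Algebra.Properties.CommutativeSemigroup (CommutativeRing.+-commutativeSemigroup xor-∧-commutativeRing)
  using () renaming (interchange to xor-interchange)
open import Data.Nat using (ℕ; zero; suc; _+_; _*_; _∸_; _<_; _≤_; s≤s; z≤n; _≡ᵇ_; _<?_)
import Data.Nat.Properties as ℕ
open import Data.Integer using (ℤ; +_; -[1+_]) renaming (_+_ to _+ℤ_; _*_ to _*ℤ_; -_ to -ℤ_)
import Data.Integer.Properties as ℤ
open import Algebra.Properties.CommutativeSemigroup ℤ.+-commutativeSemigroup
  using () renaming (interchange to +ℤ-interchange)
open import Data.Fin using (Fin; toℕ; fromℕ<; _↑ˡ_; _↑ʳ_)
import Data.Fin as Fin
open import Data.Fin.Properties using (toℕ-injective; toℕ<n; fromℕ<-toℕ; toℕ-fromℕ<; toℕ-↑ˡ; toℕ-↑ʳ)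
open import Data.Fin.Permutation using (Permutation′; _⟨$⟩ʳ_; _⟨$⟩ˡ_; inverseˡ; inverseʳ)
open import Data.Vec using ([]; _∷_; lookup; tabulate; replicate; map; _++_)
open import Data.Vec.Properties
  using (≡-dec; map-replicate; map-++; lookup∘tabulate; tabulate∘lookup; tabulate-cong; lookup-replicate;
         lookup-map; lookup-zipWith; lookup-++ˡ; lookup-++ʳ)
open import Data.List using (List; []; _∷_)
open import Data.List.Membership.Propositional using (_∈_)
open import Data.List.Relation.Unary.Any using (here; there)
import Data.List.Relation.Unary.All as All
open import Data.Product using (Σ; _×_; _,_; proj₁; proj₂)
open import Data.Product.Properties using () renaming (≡-dec to ×-≡-dec)
open import Data.Sum using (_⊎_; inj₁; inj₂)
open import Data.Empty using (⊥; ⊥-elim)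
open import Function using (_∘_)
open import Relation.Nullary using (Dec; yes; no; ¬?; _→-dec_; _⊎-dec_)
open import Relation.Nullary.Decidable using (from-yes)
open import Relation.Binary.PropositionalEquality
  using (_≡_; _≢_; refl; sym; trans; cong; cong₂; subst; module ≡-Reasoning)
open ≡-Reasoning

lookup-ext : ∀ {m} {x y : Word m} → (∀ i → lookup x i ≡ lookup y i) → x ≡ y
lookup-ext {x = x} {y} eq = trans (sym (tabulate∘lookup x)) (trans (tabulate-cong eq) (tabulate∘lookup y))

⊕-assoc : ∀ {m} (x y z : Word m) → (x ⊕ y) ⊕ z ≡ x ⊕ (y ⊕ z)
⊕-assoc []      []      []      = refl
⊕-assoc (p ∷ x) (q ∷ y) (r ∷ z) = cong₂ _∷_ (xor-assoc p q r) (⊕-assoc x y z)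

⊕-comm : ∀ {m} (x y : Word m) → x ⊕ y ≡ y ⊕ x
⊕-comm []      []      = refl
⊕-comm (p ∷ x) (q ∷ y) = cong₂ _∷_ (xor-comm p q) (⊕-comm x y)

⊕-identityˡ : ∀ {m} (x : Word m) → 𝟎 ⊕ x ≡ x
⊕-identityˡ []      = refl
⊕-identityˡ (p ∷ x) = cong (p ∷_) (⊕-identityˡ x)

⊕-identityʳ : ∀ {m} (x : Word m) → x ⊕ 𝟎 ≡ x
⊕-identityʳ x = trans (⊕-comm x 𝟎) (⊕-identityˡ x)

⊕-self : ∀ {m} (x : Word m) → x ⊕ x ≡ 𝟎
⊕-self []      = refl
⊕-self (p ∷ x) = cong₂ _∷_ (xor-same p) (⊕-self x)

⊕-cancelʳ : ∀ {m} (x y : Word m) → (x ⊕ y) ⊕ y ≡ x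
⊕-cancelʳ x y = trans (⊕-assoc x y y) (trans (cong (x ⊕_) (⊕-self y)) (⊕-identityʳ x))

map-not≡⊕𝟏 : ∀ {m} (x : Word m) → map not x ≡ x ⊕ 𝟏
map-not≡⊕𝟏 []      = refl
map-not≡⊕𝟏 (p ∷ x) = cong₂ _∷_ (xor-comm true p) (map-not≡⊕𝟏 x)

map-not-involutive : ∀ {m} (x : Word m) → map not (map not x) ≡ x
map-not-involutive x = trans (map-not≡⊕𝟏 (map not x)) (trans (cong (_⊕ 𝟏) (map-not≡⊕𝟏 x)) (⊕-cancelʳ x 𝟏))

true≢false : true ≢ false
true≢false ()

xor≡false⇒≡ : ∀ {p q} → p xor q ≡ false → p ≡ q
xor≡false⇒≡ {false} {false} _ = refl
xor≡false⇒≡ {true}  {true}  _ = refl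

𝟏≢𝟎 : ∀ {m} → 𝟏 {suc m} ≢ 𝟎
𝟏≢𝟎 ()

lookup-act : ∀ {m} (ρ : Permutation′ m) v i → lookup (act ρ v) i ≡ lookup v (ρ ⟨$⟩ˡ i)
lookup-act ρ v i = lookup∘tabulate _ i

lookup-act-⟨$⟩ʳ : ∀ {m} (ρ : Permutation′ m) v j → lookup (act ρ v) (ρ ⟨$⟩ʳ j) ≡ lookup v j
lookup-act-⟨$⟩ʳ ρ v j = trans (lookup-act ρ v _) (cong (lookup v) (inverseˡ ρ))

act-replicate : ∀ {m} (ρ : Permutation′ m) c → act ρ (replicate m c) ≡ replicate m c
act-replicate {m} ρ c = lookup-ext λ i →
  trans (lookup-act ρ (replicate m c) i) (trans (lookup-replicate (ρ ⟨$⟩ˡ i) c) (sym (lookup-replicate i c)))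

lookup-⊕ : ∀ {m} (x y : Word m) i → lookup (x ⊕ y) i ≡ lookup x i xor lookup y i
lookup-⊕ x y i = lookup-zipWith _xor_ i x y

act-⊕ : ∀ {m} (ρ : Permutation′ m) x y → act ρ (x ⊕ y) ≡ act ρ x ⊕ act ρ y
act-⊕ ρ x y = lookup-ext λ i → begin
  lookup (act ρ (x ⊕ y)) i                     ≡⟨ lookup-act ρ (x ⊕ y) i ⟩
  lookup (x ⊕ y) (ρ ⟨$⟩ˡ i)                    ≡⟨ lookup-⊕ x y _ ⟩
  lookup x (ρ ⟨$⟩ˡ i) xor lookup y (ρ ⟨$⟩ˡ i)  ≡⟨ cong₂ _xor_ (lookup-act ρ x i) (lookup-act ρ y i) ⟨
  lookup (act ρ x) i xor lookup (act ρ y) i    ≡⟨ lookup-⊕ (act ρ x) (act ρ y) i ⟨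
  lookup (act ρ x ⊕ act ρ y) i                 ∎

act-injective : ∀ {m} (ρ : Permutation′ m) {x y} → act ρ x ≡ act ρ y → x ≡ y
act-injective ρ {x} {y} eq = lookup-ext λ j →
  trans (sym (lookup-act-⟨$⟩ʳ ρ x j)) (trans (cong (λ v → lookup v (ρ ⟨$⟩ʳ j)) eq) (lookup-act-⟨$⟩ʳ ρ y j))

act-identity : ∀ {m} (ρ : Permutation′ m) → (∀ i → ρ ⟨$⟩ʳ i ≡ i) → ∀ v → act ρ v ≡ v
act-identity ρ ρ≗id v = lookup-ext λ i →
  trans (lookup-act ρ v i) (cong (lookup v) (trans (sym (ρ≗id (ρ ⟨$⟩ˡ i))) (inverseʳ ρ)))

act-∘ : ∀ {m} (ρ σ τ : Permutation′ m) → (∀ i → ρ ⟨$⟩ʳ (σ ⟨$⟩ʳ i) ≡ τ ⟨$⟩ʳ i) →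
        ∀ v → act ρ (act σ v) ≡ act τ v
act-∘ ρ σ τ ρσ≗τ v = lookup-ext λ i → begin
  lookup (act ρ (act σ v)) i    ≡⟨ lookup-act ρ (act σ v) i ⟩
  lookup (act σ v) (ρ ⟨$⟩ˡ i)   ≡⟨ lookup-act σ v _ ⟩
  lookup v (σ ⟨$⟩ˡ (ρ ⟨$⟩ˡ i))  ≡⟨ cong (lookup v) (inverse-∘ i) ⟩
  lookup v (τ ⟨$⟩ˡ i)           ≡⟨ lookup-act τ v i ⟨
  lookup (act τ v) i            ∎
  where
  inverse-∘ : ∀ i → σ ⟨$⟩ˡ (ρ ⟨$⟩ˡ i) ≡ τ ⟨$⟩ˡ i
  inverse-∘ i = trans (sym (inverseˡ τ)) (cong (τ ⟨$⟩ˡ_) (trans (sym (ρσ≗τ _))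
                (trans (cong (ρ ⟨$⟩ʳ_) (inverseʳ σ)) (inverseʳ ρ))))

-- Words read at natural-number positions (false beyond the length), the form in which
-- cycA and revB describe π_a and π_b.
bitAt : ∀ {m} → Word m → ℕ → Bool
bitAt {m} v k with k <? m
... | yes k<m = lookup v (fromℕ< k<m)
... | no  _   = false

bitAt-toℕ : ∀ {m} (v : Word m) i → bitAt v (toℕ i) ≡ lookup v i
bitAt-toℕ {m} v i with toℕ i <? m
... | yes i<m = cong (lookup v) (fromℕ<-toℕ i i<m)
... | no  i≮m = ⊥-elim (i≮m (toℕ<n i))

bitAt-fromℕ< : ∀ {m} (v : Word m) {t} (t<m : t < m) → bitAt v t ≡ lookup v (fromℕ< t<m)
bitAt-fromℕ< v t<m = trans (cong (bitAt v) (sym (toℕ-fromℕ< t<m))) (bitAt-toℕ v (fromℕ< t<m))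

bitAt-ext : ∀ {m} {x y : Word m} → (∀ t → t < m → bitAt x t ≡ bitAt y t) → x ≡ y
bitAt-ext {x = x} {y} eq = lookup-ext λ i →
  trans (sym (bitAt-toℕ x i)) (trans (eq (toℕ i) (toℕ<n i)) (bitAt-toℕ y i))

bitAt-⊕ : ∀ {m} (x y : Word m) t → bitAt (x ⊕ y) t ≡ bitAt x t xor bitAt y t
bitAt-⊕ {m} x y t with t <? m
... | yes t<m = lookup-⊕ x y _
... | no  _   = refl

bitAt-replicate : ∀ {m} c {t} → t < m → bitAt (replicate m c) t ≡ c
bitAt-replicate {m} c t<m = trans (bitAt-fromℕ< (replicate m c) t<m) (lookup-replicate {n = m} (fromℕ< t<m) c)

bitAt-map : ∀ {m} (f : Bool → Bool) (v : Word m) {t} → t < m → bitAt (map f v) t ≡ f (bitAt v t)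
bitAt-map f v t<m =
  trans (bitAt-fromℕ< (map f v) t<m) (trans (lookup-map _ f v) (cong f (sym (bitAt-fromℕ< v t<m))))

bitAt-act : ∀ {m} (ρ : Permutation′ m) {f : ℕ → ℕ} → (∀ i → toℕ (ρ ⟨$⟩ʳ i) ≡ f (toℕ i)) →
            ∀ v {t} → t < m → bitAt (act ρ v) (f t) ≡ bitAt v t
bitAt-act ρ {f} ρ≗f v {t} t<m = begin
  bitAt (act ρ v) (f t)             ≡⟨ cong (λ s → bitAt (act ρ v) (f s)) (toℕ-fromℕ< t<m) ⟨
  bitAt (act ρ v) (f (toℕ i))       ≡⟨ cong (bitAt (act ρ v)) (ρ≗f i) ⟨
  bitAt (act ρ v) (toℕ (ρ ⟨$⟩ʳ i))  ≡⟨ bitAt-toℕ (act ρ v) (ρ ⟨$⟩ʳ i) ⟩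
  lookup (act ρ v) (ρ ⟨$⟩ʳ i)       ≡⟨ lookup-act-⟨$⟩ʳ ρ v i ⟩
  lookup v i                        ≡⟨ bitAt-fromℕ< v t<m ⟨
  bitAt v t                         ∎
  where i = fromℕ< t<m

bitAt-++ˡ : ∀ {p q} (x : Word p) (y : Word q) {t} → t < p → bitAt (x ++ y) t ≡ bitAt x t
bitAt-++ˡ {q = q} x y t<p = begin
  bitAt (x ++ y) _               ≡⟨ cong (bitAt (x ++ y)) (trans (sym (toℕ-fromℕ< t<p)) (sym (toℕ-↑ˡ i q))) ⟩
  bitAt (x ++ y) (toℕ (i ↑ˡ q))  ≡⟨ bitAt-toℕ (x ++ y) (i ↑ˡ q) ⟩
  lookup (x ++ y) (i ↑ˡ q)       ≡⟨ lookup-++ˡ x y i ⟩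
  lookup x i                     ≡⟨ bitAt-fromℕ< x t<p ⟨
  bitAt x _                      ∎
  where i = fromℕ< t<p

bitAt-++ʳ : ∀ {p q} (x : Word p) (y : Word q) {s} → s < q → bitAt (x ++ y) (p + s) ≡ bitAt y s
bitAt-++ʳ {p} x y s<q = begin
  bitAt (x ++ y) (p + _)         ≡⟨ cong (bitAt (x ++ y)) (trans (cong (_+_ p) (sym (toℕ-fromℕ< s<q))) (sym (toℕ-↑ʳ p i))) ⟩
  bitAt (x ++ y) (toℕ (p ↑ʳ i))  ≡⟨ bitAt-toℕ (x ++ y) (p ↑ʳ i) ⟩
  lookup (x ++ y) (p ↑ʳ i)       ≡⟨ lookup-++ʳ x y i ⟩
  lookup y i                     ≡⟨ bitAt-fromℕ< y s<q ⟨
  bitAt y _                      ∎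
  where i = fromℕ< s<q

bitAt-vAlt : ∀ n {t} → t < 2 * n → bitAt (vAlt n) t ≡ odd t
bitAt-vAlt n t<2n = trans (bitAt-fromℕ< (vAlt n) t<2n)
  (trans (lookup∘tabulate (λ i → odd (toℕ i)) (fromℕ< t<2n)) (cong odd (toℕ-fromℕ< t<2n)))

split-< : ∀ p {q k} → k < p + q → k < p ⊎ Σ ℕ λ s → s < q × k ≡ p + s
split-< p {q} {k} k<p+q with k <? p
... | yes k<p = inj₁ k<p
... | no  k≮p = inj₂ (k ∸ p , ℕ.+-cancelˡ-< p _ _ (subst (_< p + q) (sym p+[k∸p]≡k) k<p+q) , sym p+[k∸p]≡k)
  where p+[k∸p]≡k = ℕ.m+[n∸m]≡n (ℕ.≮⇒≥ k≮p)

bitAt-ext-halves : ∀ {p q} {x y : Word (p + q)} →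
                   (∀ t → t < p → bitAt x t ≡ bitAt y t) →
                   (∀ s → s < q → bitAt x (p + s) ≡ bitAt y (p + s)) → x ≡ y
bitAt-ext-halves {p} {q} {x} {y} lower upper = bitAt-ext λ k k<p+q → halves k (split-< p k<p+q)
  where
  halves : ∀ k → k < p ⊎ Σ ℕ (λ s → s < q × k ≡ p + s) → bitAt x k ≡ bitAt y k
  halves k (inj₁ k<p)              = lower k k<p
  halves k (inj₂ (s , s<q , refl)) = upper s s<q

+ℤ-self≡0 : ∀ i → i +ℤ i ≡ + 0 → i ≡ + 0
+ℤ-self≡0 (+ zero)  _  = refl
+ℤ-self≡0 (+ suc k) eq with ℤ.+-injective eq
... | ()
+ℤ-self≡0 -[1+ k ]  ()

sumℤ< : ℕ → (ℕ → ℤ) → ℤ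
sumℤ< zero    f = + 0
sumℤ< (suc k) f = sumℤ< k f +ℤ f k

sumℤ<-cong : ∀ k {f g : ℕ → ℤ} → (∀ t → t < k → f t ≡ g t) → sumℤ< k f ≡ sumℤ< k g
sumℤ<-cong zero    f≗g = refl
sumℤ<-cong (suc k) f≗g = cong₂ _+ℤ_ (sumℤ<-cong k λ t t<k → f≗g t (ℕ.m<n⇒m<1+n t<k)) (f≗g k ℕ.≤-refl)

sumℤ<-suc : ∀ k f → sumℤ< (suc k) f ≡ f 0 +ℤ sumℤ< k (λ t → f (suc t))
sumℤ<-suc zero    f = trans (ℤ.+-identityˡ (f 0)) (sym (ℤ.+-identityʳ (f 0)))
sumℤ<-suc (suc k) f =
  trans (cong (_+ℤ f (suc k)) (sumℤ<-suc k f)) (ℤ.+-assoc (f 0) (sumℤ< k (λ t → f (suc t))) (f (suc k)))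

sumℤ<-+ : ∀ p q f → sumℤ< (p + q) f ≡ sumℤ< p f +ℤ sumℤ< q (λ s → f (p + s))
sumℤ<-+ p zero    f = trans (cong (λ k → sumℤ< k f) (ℕ.+-identityʳ p)) (sym (ℤ.+-identityʳ _))
sumℤ<-+ p (suc q) f = begin
  sumℤ< (p + suc q) f                                    ≡⟨ cong (λ k → sumℤ< k f) (ℕ.+-suc p q) ⟩
  sumℤ< (p + q) f +ℤ f (p + q)                           ≡⟨ cong (_+ℤ f (p + q)) (sumℤ<-+ p q f) ⟩
  (sumℤ< p f +ℤ sumℤ< q (λ s → f (p + s))) +ℤ f (p + q)  ≡⟨ ℤ.+-assoc (sumℤ< p f) _ _ ⟩
  sumℤ< p f +ℤ sumℤ< (suc q) (λ s → f (p + s))           ∎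

sumℤ<-neg : ∀ k f → sumℤ< k (λ t → -ℤ f t) ≡ -ℤ sumℤ< k f
sumℤ<-neg zero    f = refl
sumℤ<-neg (suc k) f = trans (cong (_+ℤ -ℤ f k) (sumℤ<-neg k f)) (sym (ℤ.neg-distrib-+ (sumℤ< k f) (f k)))

sumℤ≡sumℤ< : ∀ {m} (f : Fin m → ℤ) (g : ℕ → ℤ) → (∀ i → f i ≡ g (toℕ i)) → sumℤ f ≡ sumℤ< m g
sumℤ≡sumℤ< {zero}  f g f≗g = refl
sumℤ≡sumℤ< {suc m} f g f≗g =
  trans (cong₂ _+ℤ_ (f≗g Fin.zero) (sumℤ≡sumℤ< (λ i → f (Fin.suc i)) (λ t → g (suc t)) (λ i → f≗g (Fin.suc i))))
        (sym (sumℤ<-suc m g))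

signSum : ℕ → (ℕ → Bool) → ℤ
signSum k h = sumℤ< k (λ t → sgn (h t))

sgn-not : ∀ c → sgn (not c) ≡ -ℤ sgn c
sgn-not true  = refl
sgn-not false = refl

sgn-xor : ∀ c d → sgn c *ℤ sgn d ≡ sgn (c xor d)
sgn-xor false false = refl
sgn-xor false true  = refl
sgn-xor true  false = refl
sgn-xor true  true  = refl

signSum-not : ∀ k h → signSum k (λ t → not (h t)) ≡ -ℤ signSum k h
signSum-not k h = trans (sumℤ<-cong k λ t _ → sgn-not (h t)) (sumℤ<-neg k (λ t → sgn (h t)))

bit : Bool → ℕ
bit true  = 1
bit false = 0

weight : ℕ → (ℕ → Bool) → ℕ
weight zero    h = 0
weight (suc k) h = weight k h + bit (h k)

xor< : ℕ → (ℕ → Bool) → Bool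
xor< zero    h = false
xor< (suc k) h = xor< k h xor h k

sgn+2*bit : ∀ c → sgn c +ℤ + (2 * bit c) ≡ + 1
sgn+2*bit true  = refl
sgn+2*bit false = refl

signSum+2*weight : ∀ k h → signSum k h +ℤ + (2 * weight k h) ≡ + k
signSum+2*weight zero    h = refl
signSum+2*weight (suc k) h = begin
  (signSum k h +ℤ sgn (h k)) +ℤ + (2 * (weight k h + bit (h k)))
    ≡⟨ cong ((signSum k h +ℤ sgn (h k)) +ℤ_) (trans (cong +_ (ℕ.*-distribˡ-+ 2 (weight k h) _))
                                                   (ℤ.pos-+ (2 * weight k h) (2 * bit (h k)))) ⟩
  (signSum k h +ℤ sgn (h k)) +ℤ (+ (2 * weight k h) +ℤ + (2 * bit (h k)))
    ≡⟨ +ℤ-interchange (signSum k h) (sgn (h k)) _ _ ⟩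
  (signSum k h +ℤ + (2 * weight k h)) +ℤ (sgn (h k) +ℤ + (2 * bit (h k)))
    ≡⟨ cong₂ _+ℤ_ (signSum+2*weight k h) (sgn+2*bit (h k)) ⟩
  + (k + 1)
    ≡⟨ cong +_ (ℕ.+-comm k 1) ⟩
  + suc k ∎

odd-suc : ∀ c → odd (suc c) ≡ not (odd c)
odd-suc zero          = refl
odd-suc (suc zero)    = refl
odd-suc (suc (suc c)) = odd-suc c

odd-+ : ∀ c d → odd (c + d) ≡ odd c xor odd d
odd-+ zero    d = refl
odd-+ (suc c) d = begin
  odd (suc (c + d))      ≡⟨ odd-suc (c + d) ⟩
  not (odd (c + d))      ≡⟨ cong not (odd-+ c d) ⟩
  not (odd c xor odd d)  ≡⟨ not-distribˡ-xor (odd c) (odd d) ⟩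
  not (odd c) xor odd d  ≡⟨ cong (_xor odd d) (odd-suc c) ⟨
  odd (suc c) xor odd d  ∎

odd-bit : ∀ c → odd (bit c) ≡ c
odd-bit true  = refl
odd-bit false = refl

xor<≡odd-weight : ∀ k h → xor< k h ≡ odd (weight k h)
xor<≡odd-weight zero    h = refl
xor<≡odd-weight (suc k) h =
  trans (cong₂ _xor_ (xor<≡odd-weight k h) (sym (odd-bit (h k)))) (sym (odd-+ (weight k h) (bit (h k))))

balanced⇒2*weight≡length : ∀ k h → signSum k h ≡ + 0 → 2 * weight k h ≡ k
balanced⇒2*weight≡length k h balanced = ℤ.+-injective (begin
  + (2 * weight k h)                 ≡⟨ cong (_+ℤ + (2 * weight k h)) balanced ⟨
  signSum k h +ℤ + (2 * weight k h)  ≡⟨ signSum+2*weight k h ⟩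
  + k                                ∎)

balanced⇒xor<≡odd-half : ∀ n h → signSum (2 * n) h ≡ + 0 → xor< (2 * n) h ≡ odd n
balanced⇒xor<≡odd-half n h balanced = trans (xor<≡odd-weight (2 * n) h)
  (cong odd (ℕ.*-cancelˡ-≡ (weight (2 * n) h) n 2 (balanced⇒2*weight≡length (2 * n) h balanced)))

weight-const : ∀ k h c → (∀ t → t < k → h t ≡ c) → weight k h ≡ k * bit c
weight-const zero    h c h≗c = refl
weight-const (suc k) h c h≗c =
  trans (cong₂ _+_ (weight-const k h c λ t t<k → h≗c t (ℕ.m<n⇒m<1+n t<k)) (cong bit (h≗c k ℕ.≤-refl)))
        (ℕ.+-comm (k * bit c) (bit c))

balanced-const⇒empty : ∀ k h c → signSum k h ≡ + 0 → (∀ t → t < k → h t ≡ c) → k ≡ 0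
balanced-const⇒empty k h c balanced h≗c = cases c (trans (cong (2 *_) (sym (weight-const k h c h≗c)))
                                                         (balanced⇒2*weight≡length k h balanced))
  where
  cases : ∀ c → 2 * (k * bit c) ≡ k → k ≡ 0
  cases false 2*k*0≡k = trans (sym 2*k*0≡k) (cong (2 *_) (ℕ.*-zeroʳ k))
  cases true  2*k*1≡k = trans (sym (ℕ.+-identityʳ k)) (ℕ.+-cancelˡ-≡ k (k + 0) 0 (begin
    k + (k + 0)  ≡⟨ cong (λ j → j + (j + 0)) (ℕ.*-identityʳ k) ⟨
    2 * (k * 1)  ≡⟨ 2*k*1≡k ⟩
    k            ≡⟨ ℕ.+-identityʳ k ⟨
    k + 0        ∎))

xor<-cong : ∀ k {f g : ℕ → Bool} → (∀ t → t < k → f t ≡ g t) → xor< k f ≡ xor< k g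
xor<-cong zero    f≗g = refl
xor<-cong (suc k) f≗g = cong₂ _xor_ (xor<-cong k λ t t<k → f≗g t (ℕ.m<n⇒m<1+n t<k)) (f≗g k ℕ.≤-refl)

xor<-xor : ∀ k f g → xor< k (λ t → f t xor g t) ≡ xor< k f xor xor< k g
xor<-xor zero    f g = refl
xor<-xor (suc k) f g =
  trans (cong (_xor (f k xor g k)) (xor<-xor k f g)) (xor-interchange (xor< k f) (xor< k g) (f k) (g k))

xor<-suc : ∀ k h → xor< (suc k) h ≡ h 0 xor xor< k (λ t → h (suc t))
xor<-suc zero    h = xor-comm false (h 0)
xor<-suc (suc k) h =
  trans (cong (_xor h (suc k)) (xor<-suc k h)) (xor-assoc (h 0) (xor< k (λ t → h (suc t))) (h (suc k)))

xor<-rotate : ∀ k (f : ℕ → Bool) (ρ : ℕ → ℕ) → (∀ t → t < k → ρ t ≡ suc t) → ρ k ≡ 0 →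
              xor< (suc k) (λ t → f (ρ t)) ≡ xor< (suc k) f
xor<-rotate k f ρ ρ-shift ρ-wrap = begin
  xor< k (λ t → f (ρ t)) xor f (ρ k)  ≡⟨ cong₂ _xor_ (xor<-cong k λ t t<k → cong f (ρ-shift t t<k)) (cong f ρ-wrap) ⟩
  xor< k (λ t → f (suc t)) xor f 0    ≡⟨ xor-comm (xor< k (λ t → f (suc t))) (f 0) ⟩
  f 0 xor xor< k (λ t → f (suc t))    ≡⟨ xor<-suc k f ⟨
  xor< (suc k) f                      ∎

stepwise-constant : ∀ k (f : ℕ → Bool) → (∀ t → suc t < k → f (suc t) ≡ f t) → ∀ t → t < k → f t ≡ f 0
stepwise-constant k f step zero    _   = refl
stepwise-constant k f step (suc t) t<k = trans (step t t<k) (stepwise-constant k f step t (ℕ.<-trans (ℕ.n<1+n t) t<k))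

stepwise-alternating : ∀ k (f : ℕ → Bool) → (∀ t → suc t < k → f (suc t) ≡ not (f t)) →
                       ∀ t → t < k → f t ≡ odd t xor f 0
stepwise-alternating k f step zero    _   = refl
stepwise-alternating k f step (suc t) t<k = begin
  f (suc t)            ≡⟨ step t t<k ⟩
  not (f t)            ≡⟨ cong not (stepwise-alternating k f step t (ℕ.<-trans (ℕ.n<1+n t) t<k)) ⟩
  not (odd t xor f 0)  ≡⟨ not-distribˡ-xor (odd t) (f 0) ⟩
  not (odd t) xor f 0  ≡⟨ cong (_xor f 0) (odd-suc t) ⟨
  odd (suc t) xor f 0  ∎

2*suc≡2⊎2<2*suc : ∀ m → 2 * suc m ≡ 2 ⊎ 2 < 2 * suc m
2*suc≡2⊎2<2*suc zero    = inj₁ refl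
2*suc≡2⊎2<2*suc (suc m) = inj₂ (s≤s (s≤s (ℕ.≤-trans (s≤s z≤n) (ℕ.m≤n+m _ m))))

≡ᵇ-false : ∀ {k j} → k ≢ j → (k ≡ᵇ j) ≡ false
≡ᵇ-false {k} {j} k≢j with k ≡ᵇ j in eq
... | true  = ⊥-elim (k≢j (ℕ.≡ᵇ⇒≡ k j (subst T (sym eq) _)))
... | false = refl

≡ᵇ-true : ∀ {k j} → k ≡ j → (k ≡ᵇ j) ≡ true
≡ᵇ-true {k} {j} k≡j with k ≡ᵇ j in eq
... | true  = refl
... | false = ⊥-elim (subst T eq (ℕ.≡⇒≡ᵇ k j k≡j))

4*n≡2*n+2*n : ∀ n → 4 * n ≡ 2 * n + 2 * n
4*n≡2*n+2*n n = ℕ.*-distribʳ-+ n 2 2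

2*n≤4*n : ∀ n → 2 * n ≤ 4 * n
2*n≤4*n n = subst (2 * n ≤_) (sym (4*n≡2*n+2*n n)) (ℕ.m≤m+n (2 * n) (2 * n))

2*suc≤revB-0 : ∀ m → 2 * suc m ≤ revB (suc m) 0
2*suc≤revB-0 m = ℕ.<⇒≤pred (subst (2 * suc m <_) (sym (4*n≡2*n+2*n (suc m))) (ℕ.m<m+n (2 * suc m) (s≤s z≤n)))

cycA-lower : ∀ n {t} → suc t < 2 * n → cycA n t ≡ suc t
cycA-lower n {t} t+1<2n
  rewrite ≡ᵇ-false (ℕ.<⇒≢ t+1<2n)
        | ≡ᵇ-false (ℕ.<⇒≢ (ℕ.<-≤-trans t+1<2n (2*n≤4*n n))) = refl

cycA-lower-wrap : ∀ n {t} → suc t ≡ 2 * n → cycA n t ≡ 0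
cycA-lower-wrap n t+1≡2n rewrite ≡ᵇ-true t+1≡2n = refl

cycA-upper : ∀ n {s} → suc s < 2 * n → cycA n (2 * n + s) ≡ 2 * n + suc s
cycA-upper n {s} s+1<2n
  rewrite ≡ᵇ-false {suc (2 * n + s)} (λ eq → ℕ.<-irrefl (sym eq) (s≤s (ℕ.m≤m+n (2 * n) s)))
        | ≡ᵇ-false {suc (2 * n + s)} (ℕ.<⇒≢ (subst (_< 4 * n) (ℕ.+-suc (2 * n) s)
                                            (subst (2 * n + suc s <_) (sym (4*n≡2*n+2*n n)) (ℕ.+-monoʳ-< (2 * n) s+1<2n))))
        = sym (ℕ.+-suc (2 * n) s)

cycA-upper-wrap : ∀ n {s} → suc s ≡ 2 * n → cycA n (2 * n + s) ≡ 2 * n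
cycA-upper-wrap n {s} s+1≡2n
  rewrite ≡ᵇ-false {suc (2 * n + s)} (λ eq → ℕ.<-irrefl (sym eq) (s≤s (ℕ.m≤m+n (2 * n) s)))
        | ≡ᵇ-true {suc (2 * n + s)} (trans (sym (ℕ.+-suc (2 * n) s))
                                    (trans (cong (_+_ (2 * n)) s+1≡2n) (sym (4*n≡2*n+2*n n)))) = refl

cycA-preserves-upper : ∀ n {t} → 2 * n ≤ t → 2 * n ≤ cycA n t
cycA-preserves-upper n {t} 2n≤t rewrite ≡ᵇ-false {suc t} (λ eq → ℕ.<-irrefl (sym eq) (s≤s 2n≤t)) with suc t ≡ᵇ 4 * n
... | true  = ℕ.≤-refl
... | false = ℕ.m≤n⇒m≤1+n 2n≤t

cycA-lower-half : ∀ n {t} → 0 < n → t < 2 * n → cycA n t < 2 * n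
cycA-lower-half n {t} 0<n t<2n with ℕ.m≤n⇒m<n∨m≡n t<2n
... | inj₁ t+1<2n = subst (_< 2 * n) (sym (cycA-lower n t+1<2n)) t+1<2n
... | inj₂ t+1≡2n = subst (_< 2 * n) (sym (cycA-lower-wrap n t+1≡2n)) (ℕ.<-≤-trans 0<n (ℕ.m≤m+n n _))

cycA-upper-half : ∀ n {s} → 0 < n → s < 2 * n → Σ ℕ λ s′ → s′ < 2 * n × cycA n (2 * n + s) ≡ 2 * n + s′
cycA-upper-half n {s} 0<n s<2n with ℕ.m≤n⇒m<n∨m≡n s<2n
... | inj₁ s+1<2n = suc s , s+1<2n , cycA-upper n s+1<2n
... | inj₂ s+1≡2n = 0 , ℕ.<-≤-trans 0<n (ℕ.m≤m+n n _) , trans (cycA-upper-wrap n s+1≡2n) (sym (ℕ.+-identityʳ (2 * n)))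

iterate : (ℕ → ℕ) → ℕ → ℕ → ℕ
iterate f zero    t = t
iterate f (suc k) t = f (iterate f k t)

iterate-cycA-lower : ∀ n {k} → k < 2 * n → iterate (cycA n) k 0 ≡ k
iterate-cycA-lower n {zero}  _      = refl
iterate-cycA-lower n {suc k} k+1<2n =
  trans (cong (cycA n) (iterate-cycA-lower n (ℕ.<-trans (ℕ.n<1+n k) k+1<2n))) (cycA-lower n k+1<2n)

iterate-cycA-period : ∀ n → iterate (cycA n) (2 * n) 0 ≡ 0
iterate-cycA-period zero    = refl
iterate-cycA-period (suc m) =
  trans (cong (cycA (suc m)) (iterate-cycA-lower (suc m) ℕ.≤-refl)) (cycA-lower-wrap (suc m) refl)

iterate-cycA-preserves-upper : ∀ n k {t} → 2 * n ≤ t → 2 * n ≤ iterate (cycA n) k t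
iterate-cycA-preserves-upper n zero    2n≤t = 2n≤t
iterate-cycA-preserves-upper n (suc k) 2n≤t = cycA-preserves-upper n (iterate-cycA-preserves-upper n k 2n≤t)

Bool² : Set
Bool² = Bool × Bool

_⊕²_ : Bool² → Bool² → Bool²
(c , d) ⊕² (c′ , d′) = c xor c′ , d xor d′

𝟘² : Bool²
𝟘² = false , false

_≟²_ : (x y : Bool²) → Dec (x ≡ y)
_≟²_ = ×-≡-dec _≟ᴮ_ _≟ᴮ_

Bool²-elements : List Bool²
Bool²-elements = (false , false) ∷ (false , true) ∷ (true , false) ∷ (true , true) ∷ []

∈-Bool²-elements : ∀ x → x ∈ Bool²-elements
∈-Bool²-elements (false , false) = here refl
∈-Bool²-elements (false , true)  = there (here refl)
∈-Bool²-elements (true , false)  = there (there (here refl))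
∈-Bool²-elements (true , true)   = there (there (there (here refl)))

ThirdNonzero² : Bool² → Bool² → Bool² → Set
ThirdNonzero² x y z = x ≢ 𝟘² → y ≢ 𝟘² → z ≢ 𝟘² → x ≢ y → z ≡ x ⊎ z ≡ y ⊎ z ≡ x ⊕² y

thirdNonzero² : ∀ x y z → ThirdNonzero² x y z
thirdNonzero² x y z =
  All.lookup (All.lookup (All.lookup table (∈-Bool²-elements x)) (∈-Bool²-elements y)) (∈-Bool²-elements z)
  where
  decide : ∀ x y z → Dec (ThirdNonzero² x y z)
  decide x y z = ¬? (x ≟² 𝟘²) →-dec ¬? (y ≟² 𝟘²) →-dec ¬? (z ≟² 𝟘²) →-dec ¬? (x ≟² y) →-dec
                 ((z ≟² x) ⊎-dec (z ≟² y) ⊎-dec (z ≟² (x ⊕² y)))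
  table : All.All (λ x → All.All (λ y → All.All (ThirdNonzero² x y) Bool²-elements) Bool²-elements) Bool²-elements
  table =
    from-yes (All.all? (λ x → All.all? (λ y → All.all? (decide x y) Bool²-elements) Bool²-elements) Bool²-elements)

⊕-interchange : ∀ {m} (x y z v : Word m) → (x ⊕ y) ⊕ (z ⊕ v) ≡ (x ⊕ z) ⊕ (y ⊕ v)
⊕-interchange []      []      []      []      = refl
⊕-interchange (p ∷ x) (q ∷ y) (r ∷ z) (s ∷ v) = cong₂ _∷_ (xor-interchange p q r s) (⊕-interchange x y z v)

scal-false : ∀ {m} (v : Word m) → scal false v ≡ 𝟎
scal-false []      = refl
scal-false (p ∷ v) = cong (false ∷_) (scal-false v)

scal-true : ∀ {m} (v : Word m) → scal true v ≡ v
scal-true []      = refl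
scal-true (p ∷ v) = cong (p ∷_) (scal-true v)

scal-⊕ : ∀ {m} c c′ (v : Word m) → scal c v ⊕ scal c′ v ≡ scal (c xor c′) v
scal-⊕ false c′ v rewrite scal-false v = ⊕-identityˡ (scal c′ v)
scal-⊕ true false v rewrite scal-true v | scal-false v = ⊕-identityʳ v
scal-⊕ true true  v rewrite scal-true v | scal-false v = ⊕-self v

Kernel-intro : ∀ {m} {C : Word m → Set} {z} → (∀ {x} → C x → C (x ⊕ z)) → Kernel C z
Kernel-intro {C = C} {z} ⊕z-closed x = ⊕z-closed , λ x⊕z∈C → subst C (⊕-cancelʳ x z) (⊕z-closed x⊕z∈C)

Kernel-𝟎 : ∀ {m} {C : Word m → Set} → Kernel C 𝟎
Kernel-𝟎 {C = C} = Kernel-intro λ {x} x∈C → subst C (sym (⊕-identityʳ x)) x∈C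

Kernel⊆ : ∀ {m} {C : Word m → Set} {z} → C 𝟎 → Kernel C z → C z
Kernel⊆ {C = C} {z} 𝟎∈C z∈K = subst C (⊕-identityˡ z) (proj₁ (z∈K 𝟎) 𝟎∈C)

Kernel-⊕ : ∀ {m} {C : Word m → Set} {z z′} → Kernel C z → Kernel C z′ → Kernel C (z ⊕ z′)
Kernel-⊕ {C = C} {z} {z′} z∈K z′∈K = Kernel-intro λ {x} x∈C →
  subst C (⊕-assoc x z z′) (proj₁ (z′∈K (x ⊕ z)) (proj₁ (z∈K x) x∈C))

Kernel-𝟏 : ∀ {m} {C : Word m → Set} → (∀ {x} → C x → C (map not x)) → Kernel C 𝟏
Kernel-𝟏 {C = C} complement-closed = Kernel-intro λ {x} x∈C → subst C (map-not≡⊕𝟏 x) (complement-closed x∈C)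

module KernelOfDimension2 {m} {C : Word m → Set} (dim2 : KernelDim2 C) where

  u w : Word m
  u = proj₁ dim2
  w = proj₁ (proj₂ dim2)

  u≢𝟎 : u ≢ 𝟎
  u≢𝟎 = proj₁ (proj₂ (proj₂ dim2))

  w≢𝟎 : w ≢ 𝟎
  w≢𝟎 = proj₁ (proj₂ (proj₂ (proj₂ dim2)))

  u≢w : u ≢ w
  u≢w = proj₁ (proj₂ (proj₂ (proj₂ (proj₂ dim2))))

  combination : Bool² → Word m
  combination (c , d) = scal c u ⊕ scal d w

  Kernel⇔combination : ∀ z → (Kernel C z → Σ Bool λ c → Σ Bool λ d → z ≡ combination (c , d))
                           × ((Σ Bool λ c → Σ Bool λ d → z ≡ combination (c , d)) → Kernel C z)
  Kernel⇔combination = proj₂ (proj₂ (proj₂ (proj₂ (proj₂ dim2))))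

  Kernel⇒combination : ∀ {z} → Kernel C z → Σ Bool² λ x → z ≡ combination x
  Kernel⇒combination {z} z∈K with proj₁ (Kernel⇔combination z) z∈K
  ... | c , d , z≡ = (c , d) , z≡

  combination∈Kernel : ∀ x → Kernel C (combination x)
  combination∈Kernel (c , d) = proj₂ (Kernel⇔combination _) (c , d , refl)

  combination-𝟘² : combination 𝟘² ≡ 𝟎
  combination-𝟘² = trans (cong₂ _⊕_ (scal-false u) (scal-false w)) (⊕-self 𝟎)

  combination-⊕² : ∀ x y → combination (x ⊕² y) ≡ combination x ⊕ combination y
  combination-⊕² (c , d) (c′ , d′) = sym (trans (⊕-interchange (scal c u) (scal d w) (scal c′ u) (scal d′ w))
                                                 (cong₂ _⊕_ (scal-⊕ c c′ u) (scal-⊕ d d′ w)))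

  u∈Kernel : Kernel C u
  u∈Kernel = subst (Kernel C) (trans (cong₂ _⊕_ (scal-true u) (scal-false w)) (⊕-identityʳ u))
                   (combination∈Kernel (true , false))

  w∈Kernel : Kernel C w
  w∈Kernel = subst (Kernel C) (trans (cong₂ _⊕_ (scal-false u) (scal-true w)) (⊕-identityˡ w))
                   (combination∈Kernel (false , true))

  ∃-Kernel-≢𝟎-≢𝟏 : Σ (Word m) λ z → Kernel C z × z ≢ 𝟎 × z ≢ 𝟏
  ∃-Kernel-≢𝟎-≢𝟏 with ≡-dec _≟ᴮ_ u 𝟏
  ... | no  u≢𝟏 = u , u∈Kernel , u≢𝟎 , u≢𝟏
  ... | yes u≡𝟏 = w , w∈Kernel , w≢𝟎 , λ w≡𝟏 → u≢w (trans u≡𝟏 (sym w≡𝟏))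

  Kernel-third : ∀ {p q r} → Kernel C p → Kernel C q → Kernel C r → p ≢ 𝟎 → q ≢ 𝟎 → r ≢ 𝟎 → p ≢ q →
                 r ≡ p ⊎ r ≡ q ⊎ r ≡ p ⊕ q
  Kernel-third p∈K q∈K r∈K p≢𝟎 q≢𝟎 r≢𝟎 p≢q
    with Kernel⇒combination p∈K | Kernel⇒combination q∈K | Kernel⇒combination r∈K
  ... | x , refl | y , refl | z , refl =
    lift (thirdNonzero² x y z (nonzero p≢𝟎) (nonzero q≢𝟎) (nonzero r≢𝟎) (λ x≡y → p≢q (cong combination x≡y)))
    where
    nonzero : ∀ {x} → combination x ≢ 𝟎 → x ≢ 𝟘²
    nonzero ≢𝟎 x≡𝟘² = ≢𝟎 (trans (cong combination x≡𝟘²) combination-𝟘²)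
    lift : z ≡ x ⊎ z ≡ y ⊎ z ≡ x ⊕² y →
           combination z ≡ combination x ⊎ combination z ≡ combination y ⊎ combination z ≡ combination x ⊕ combination y
    lift (inj₁ z≡x)          = inj₁ (cong combination z≡x)
    lift (inj₂ (inj₁ z≡y))   = inj₂ (inj₁ (cong combination z≡y))
    lift (inj₂ (inj₂ z≡x⊕y)) = inj₂ (inj₂ (trans (cong combination z≡x⊕y) (combination-⊕² x y)))

correlation : ∀ {m} → Word m → Word m → ℤ
correlation x y = sumℤ (λ k → sgn (lookup x k) *ℤ sgn (lookup y k))

correlation≡signSum : ∀ {m} (x y : Word m) → correlation x y ≡ signSum m (bitAt (x ⊕ y))
correlation≡signSum x y = sumℤ≡sumℤ< _ _ λ i → begin
  sgn (lookup x i) *ℤ sgn (lookup y i)  ≡⟨ sgn-xor (lookup x i) (lookup y i) ⟩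
  sgn (lookup x i xor lookup y i)       ≡⟨ cong sgn (lookup-⊕ x y i) ⟨
  sgn (lookup (x ⊕ y) i)                ≡⟨ cong sgn (bitAt-toℕ (x ⊕ y) i) ⟨
  sgn (bitAt (x ⊕ y) (toℕ i))           ∎

signSum-bitAt-not : ∀ {m} (v : Word m) → signSum m (bitAt (map not v)) ≡ -ℤ signSum m (bitAt v)
signSum-bitAt-not {m} v = trans (sumℤ<-cong m λ t t<m → cong sgn (bitAt-map not v t<m)) (signSum-not m (bitAt v))

correlation-notˡ : ∀ {m} (x y : Word m) → correlation (map not x) y ≡ -ℤ correlation x y
correlation-notˡ {m} x y = begin
  correlation (map not x) y            ≡⟨ correlation≡signSum (map not x) y ⟩
  signSum m (bitAt (map not x ⊕ y))    ≡⟨ cong (λ v → signSum m (bitAt v)) not-x⊕y ⟩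
  signSum m (bitAt (map not (x ⊕ y)))  ≡⟨ signSum-bitAt-not (x ⊕ y) ⟩
  -ℤ signSum m (bitAt (x ⊕ y))         ≡⟨ cong -ℤ_ (correlation≡signSum x y) ⟨
  -ℤ correlation x y                   ∎
  where
  not-x⊕y : map not x ⊕ y ≡ map not (x ⊕ y)
  not-x⊕y = begin
    map not x ⊕ y    ≡⟨ cong (_⊕ y) (map-not≡⊕𝟏 x) ⟩
    (x ⊕ 𝟏) ⊕ y      ≡⟨ ⊕-assoc x 𝟏 y ⟩
    x ⊕ (𝟏 ⊕ y)      ≡⟨ cong (x ⊕_) (⊕-comm 𝟏 y) ⟩
    x ⊕ (y ⊕ 𝟏)      ≡⟨ ⊕-assoc x y 𝟏 ⟨
    (x ⊕ y) ⊕ 𝟏      ≡⟨ map-not≡⊕𝟏 (x ⊕ y) ⟨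
    map not (x ⊕ y)  ∎

correlation-comm : ∀ {m} (x y : Word m) → correlation x y ≡ correlation y x
correlation-comm {m} x y =
  trans (correlation≡signSum x y) (trans (cong (λ v → signSum m (bitAt v)) (⊕-comm x y)) (sym (correlation≡signSum y x)))

correlation-notʳ : ∀ {m} (x y : Word m) → correlation x (map not y) ≡ -ℤ correlation x y
correlation-notʳ x y =
  trans (correlation-comm x (map not y)) (trans (correlation-notˡ y x) (cong -ℤ_ (correlation-comm y x)))

module HadamardCode {m} {C : Word m → Set} (hadamard : IsHadamardCode m C) where

  private
    H : Fin m → Word m
    H = proj₁ hadamard

    Signed : Word m → Word m → Set
    Signed v x = x ≡ v ⊎ x ≡ map not v

    row-of : ∀ {x} → C x → Σ (Fin m) λ i → Signed (H i) x
    row-of {x} = proj₁ (proj₂ (proj₂ hadamard) x)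

    from-row : ∀ {x} i → Signed (H i) x → C x
    from-row {x} i x≡±Hi = proj₂ (proj₂ (proj₂ hadamard) x) (i , x≡±Hi)

    rows-orthogonal : ∀ {i j} → i ≢ j → correlation (H i) (H j) ≡ + 0
    rows-orthogonal {i} {j} i≢j with i Fin.≟ j | proj₁ (proj₂ hadamard) i j
    ... | yes i≡j | _     = ⊥-elim (i≢j i≡j)
    ... | no  _   | Hi⊥Hj = Hi⊥Hj

    signed-orthogonal : ∀ {u v x y} → Signed u x → Signed v y → correlation u v ≡ + 0 → correlation x y ≡ + 0
    signed-orthogonal (inj₁ refl) (inj₁ refl) u⊥v = u⊥v
    signed-orthogonal {u} {v} (inj₁ refl) (inj₂ refl) u⊥v = trans (correlation-notʳ u v) (cong -ℤ_ u⊥v)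
    signed-orthogonal {u} {v} (inj₂ refl) (inj₁ refl) u⊥v = trans (correlation-notˡ u v) (cong -ℤ_ u⊥v)
    signed-orthogonal {u} {v} (inj₂ refl) (inj₂ refl) u⊥v =
      trans (correlation-notˡ u (map not v)) (cong -ℤ_ (trans (correlation-notʳ u v) (cong -ℤ_ u⊥v)))

    same-row : ∀ {v x y} → Signed v x → Signed v y → x ≢ y → x ≢ map not y → ⊥
    same-row (inj₁ refl) (inj₁ refl) x≢y _    = x≢y refl
    same-row (inj₁ refl) (inj₂ refl) _   x≢¬y = x≢¬y (sym (map-not-involutive _))
    same-row (inj₂ refl) (inj₁ refl) _   x≢¬y = x≢¬y refl
    same-row (inj₂ refl) (inj₂ refl) x≢y _    = x≢y refl

  complement-closed : ∀ {x} → C x → C (map not x)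
  complement-closed x∈C with row-of x∈C
  ... | i , inj₁ x≡Hi  = from-row i (inj₂ (cong (map not) x≡Hi))
  ... | i , inj₂ x≡¬Hi = from-row i (inj₁ (trans (cong (map not) x≡¬Hi) (map-not-involutive (H i))))

  orthogonal : ∀ {x y} → C x → C y → x ≢ y → x ≢ map not y → correlation x y ≡ + 0
  orthogonal x∈C y∈C x≢y x≢¬y with row-of x∈C | row-of y∈C
  ... | i , x≡±Hi | j , y≡±Hj with i Fin.≟ j
  ... | yes refl = ⊥-elim (same-row x≡±Hi y≡±Hj x≢y x≢¬y)
  ... | no  i≢j  = signed-orthogonal x≡±Hi y≡±Hj (rows-orthogonal i≢j)

module PropelinearGroup {m} {C : Word m → Set} {π : Word m → Permutation′ m}
                        (propelinear : IsPropelinear C π) (π𝟎≗id : ∀ i → π 𝟎 ⟨$⟩ʳ i ≡ i) where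

  infixl 7 _·_
  _·_ : Word m → Word m → Word m
  x · y = x ·[ π ] y

  𝟎∈C : C 𝟎
  𝟎∈C = proj₁ propelinear

  ·-closed : ∀ {x y} → C x → C y → C (x · y)
  ·-closed = proj₁ (proj₂ propelinear) _ _

  π-· : ∀ {x y} → C x → C y → ∀ i → π x ⟨$⟩ʳ (π y ⟨$⟩ʳ i) ≡ π (x · y) ⟨$⟩ʳ i
  π-· = proj₂ (proj₂ propelinear) _ _

  ·-assoc : ∀ {x y} → C x → C y → ∀ z → (x · y) · z ≡ x · (y · z)
  ·-assoc {x} {y} x∈C y∈C z = begin
    (x ⊕ act (π x) y) ⊕ act (π (x · y)) z        ≡⟨ ⊕-assoc x _ _ ⟩
    x ⊕ (act (π x) y ⊕ act (π (x · y)) z)        ≡⟨ cong (λ v → x ⊕ (act (π x) y ⊕ v)) act-πx∘πy ⟨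
    x ⊕ (act (π x) y ⊕ act (π x) (act (π y) z))  ≡⟨ cong (x ⊕_) (act-⊕ (π x) y _) ⟨
    x ⊕ act (π x) (y · z)                        ∎
    where
    act-πx∘πy : act (π x) (act (π y) z) ≡ act (π (x · y)) z
    act-πx∘πy = act-∘ (π x) (π y) (π (x · y)) (π-· x∈C y∈C) z

  ·-identityˡ : ∀ z → 𝟎 · z ≡ z
  ·-identityˡ z = trans (cong (𝟎 ⊕_) (act-identity (π 𝟎) π𝟎≗id z)) (⊕-identityˡ z)

  ·-identityʳ : ∀ x → x · 𝟎 ≡ x
  ·-identityʳ x = trans (cong (x ⊕_) (act-replicate (π x) false)) (⊕-identityʳ x)

  pow-closed : ∀ {x} k → C x → C (pow π x k)
  pow-closed zero    x∈C = 𝟎∈C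
  pow-closed (suc k) x∈C = ·-closed x∈C (pow-closed k x∈C)

  pow-+ : ∀ {x} i j → C x → pow π x (i + j) ≡ pow π x i · pow π x j
  pow-+ {x} zero j x∈C = sym (·-identityˡ (pow π x j))
  pow-+ {x} (suc i) j x∈C = trans (cong (x ·_) (pow-+ i j x∈C)) (sym (·-assoc x∈C (pow-closed i x∈C) (pow π x j)))

  pow-1 : ∀ x → pow π x 1 ≡ x
  pow-1 x = ·-identityʳ x

  pow-sucʳ : ∀ {x} k → C x → pow π x (suc k) ≡ pow π x k · x
  pow-sucʳ {x} k x∈C = trans (cong (pow π x) (ℕ.+-comm 1 k)) (trans (pow-+ k 1 x∈C) (cong (pow π x k ·_) (pow-1 x)))

  toℕ-π-pow : ∀ {x} {f : ℕ → ℕ} → C x → (∀ i → toℕ (π x ⟨$⟩ʳ i) ≡ f (toℕ i)) →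
              ∀ k i → toℕ (π (pow π x k) ⟨$⟩ʳ i) ≡ iterate f k (toℕ i)
  toℕ-π-pow x∈C πx≗f zero    i = cong toℕ (π𝟎≗id i)
  toℕ-π-pow {f = f} x∈C πx≗f (suc k) i =
    trans (cong toℕ (sym (π-· x∈C (pow-closed k x∈C) i))) (trans (πx≗f _) (cong f (toℕ-π-pow x∈C πx≗f k i)))

  Kernel-act : ∀ {a a⁻ z} → C a → C a⁻ → a · a⁻ ≡ 𝟎 → Kernel C z → Kernel C (act (π a) z)
  Kernel-act {a} {a⁻} {z} a∈C a⁻∈C aa⁻≡𝟎 z∈K = Kernel-intro λ {y} y∈C →
    subst C (shifted y) (·-closed a∈C (proj₁ (z∈K (a⁻ · y)) (·-closed a⁻∈C y∈C)))
    where
    shifted : ∀ y → a · ((a⁻ · y) ⊕ z) ≡ y ⊕ act (π a) z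
    shifted y = begin
      a ⊕ act (π a) ((a⁻ · y) ⊕ z)            ≡⟨ cong (a ⊕_) (act-⊕ (π a) (a⁻ · y) z) ⟩
      a ⊕ (act (π a) (a⁻ · y) ⊕ act (π a) z)  ≡⟨ ⊕-assoc a _ _ ⟨
      (a · (a⁻ · y)) ⊕ act (π a) z            ≡⟨ cong (_⊕ act (π a) z) (·-assoc a∈C a⁻∈C y) ⟨
      ((a · a⁻) · y) ⊕ act (π a) z            ≡⟨ cong (λ v → (v · y) ⊕ act (π a) z) aa⁻≡𝟎 ⟩
      (𝟎 · y) ⊕ act (π a) z                   ≡⟨ cong (_⊕ act (π a) z) (·-identityˡ y) ⟩
      y ⊕ act (π a) z                         ∎

module TypeQ (m : ℕ) {C : Word (len (suc m)) → Set} {π : Word (len (suc m)) → Permutation′ (len (suc m))}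
             {a : Word (len (suc m))} (propelinear : IsPropelinear C π) (hadamard : IsHadamardCode (len (suc m)) C)
             (π𝟎≗id : ∀ i → π 𝟎 ⟨$⟩ʳ i ≡ i) (a∈C : C a)
             (πa≗cycA : ∀ i → toℕ (π a ⟨$⟩ʳ i) ≡ cycA (suc m) (toℕ i)) where

  open PropelinearGroup {C = C} {π = π} propelinear π𝟎≗id public
  open HadamardCode {C = C} hadamard public

  n 2n 2n-1 L : ℕ
  n    = suc m
  2n   = 2 * n
  2n-1 = m + suc (m + 0)  -- so that suc 2n-1 and 2n are definitionally equal
  L    = len n

  0<n : 0 < n
  0<n = s≤s z≤n

  0<2n : 0 < 2n
  0<2n = ℕ.<-≤-trans 0<n (ℕ.m≤m+n n _)

  <2n⇒<L : ∀ {t} → t < 2n → t < L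
  <2n⇒<L t<2n = ℕ.<-≤-trans t<2n (ℕ.m≤m+n 2n 2n)

  a^ : ℕ → Word L
  a^ k = pow π a k

  toℕ-π-a^ : ∀ k i → toℕ (π (a^ k) ⟨$⟩ʳ i) ≡ iterate (cycA n) k (toℕ i)
  toℕ-π-a^ = toℕ-π-pow a∈C πa≗cycA

  𝟏∈C : C 𝟏
  𝟏∈C = subst C (map-replicate not false L) (complement-closed 𝟎∈C)

  HalfStart : ℕ → Set
  HalfStart o = o ≡ 0 ⊎ o ≡ 2n

  lower : HalfStart 0
  lower = inj₁ refl

  upper : HalfStart 2n
  upper = inj₂ refl

  halfStart+<L : ∀ {o t} → HalfStart o → t < 2n → o + t < L
  halfStart+<L (inj₁ refl) t<2n = <2n⇒<L t<2n
  halfStart+<L (inj₂ refl) t<2n = ℕ.+-monoʳ-< 2n t<2n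

  bitAt-act-a-shift : ∀ {o t} → HalfStart o → suc t < 2n → ∀ x → bitAt (act (π a) x) (o + suc t) ≡ bitAt x (o + t)
  bitAt-act-a-shift {o} {t} half t+1<2n x =
    trans (cong (bitAt (act (π a) x)) (sym (shift half)))
          (bitAt-act (π a) {cycA n} πa≗cycA x (halfStart+<L half (ℕ.<-trans (ℕ.n<1+n t) t+1<2n)))
    where
    shift : HalfStart o → cycA n (o + t) ≡ o + suc t
    shift (inj₁ refl) = cycA-lower n t+1<2n
    shift (inj₂ refl) = cycA-upper n t+1<2n

  act-a-fixed : ∀ {x} → (∀ t → t < L → bitAt x (cycA n t) ≡ bitAt x t) → act (π a) x ≡ x
  act-a-fixed {x} fixed = lookup-ext fixed-at
    where
    fixed-at : ∀ i → lookup (act (π a) x) i ≡ lookup x i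
    fixed-at i = begin
      lookup (act (π a) x) i             ≡⟨ cong (lookup (act (π a) x)) (inverseʳ (π a)) ⟨
      lookup (act (π a) x) (π a ⟨$⟩ʳ j)  ≡⟨ lookup-act-⟨$⟩ʳ (π a) x j ⟩
      lookup x j                         ≡⟨ bitAt-toℕ x j ⟨
      bitAt x (toℕ j)                    ≡⟨ fixed (toℕ j) (toℕ<n j) ⟨
      bitAt x (cycA n (toℕ j))           ≡⟨ cong (bitAt x) (πa≗cycA j) ⟨
      bitAt x (toℕ (π a ⟨$⟩ʳ j))         ≡⟨ bitAt-toℕ x (π a ⟨$⟩ʳ j) ⟩
      lookup x (π a ⟨$⟩ʳ j)              ≡⟨ cong (lookup x) (inverseʳ (π a)) ⟩
      lookup x i                         ∎
      where j = π a ⟨$⟩ˡ i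

  act-a≡replicate : ∀ {x c} → act (π a) x ≡ replicate L c → x ≡ replicate L c
  act-a≡replicate {c = c} eq = act-injective (π a) (trans eq (sym (act-replicate (π a) c)))

  infix 8 _‖_
  _‖_ : Bool → Bool → Word L
  c ‖ d = replicate 2n c ++ replicate 2n d

  bitAt-‖-lower : ∀ c d {t} → t < 2n → bitAt (c ‖ d) t ≡ c
  bitAt-‖-lower c d t<2n = trans (bitAt-++ˡ (replicate 2n c) (replicate 2n d) t<2n) (bitAt-replicate c t<2n)

  bitAt-‖-upper : ∀ c d {s} → s < 2n → bitAt (c ‖ d) (2n + s) ≡ d
  bitAt-‖-upper c d s<2n = trans (bitAt-++ʳ {2n} (replicate 2n c) (replicate 2n d) s<2n) (bitAt-replicate d s<2n)

  ‖-same : ∀ c → c ‖ c ≡ replicate L c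
  ‖-same c = bitAt-ext-halves {2n} {2n}
    (λ t t<2n → trans (bitAt-‖-lower c c t<2n) (sym (bitAt-replicate c (<2n⇒<L t<2n))))
    (λ s s<2n → trans (bitAt-‖-upper c c s<2n) (sym (bitAt-replicate c (ℕ.+-monoʳ-< 2n s<2n))))

  map-not-‖ : ∀ c d → map not (c ‖ d) ≡ not c ‖ not d
  map-not-‖ c d = trans (map-++ not (replicate 2n c) (replicate 2n d))
                        (cong₂ _++_ (map-replicate not c 2n) (map-replicate not d 2n))

  ‖-injective : ∀ {c d c′ d′} → c ‖ d ≡ c′ ‖ d′ → c ≡ c′ × d ≡ d′
  ‖-injective {c} {d} {c′} {d′} eq =
    trans (sym (bitAt-‖-lower c d 0<2n)) (trans (cong (λ v → bitAt v 0) eq) (bitAt-‖-lower c′ d′ 0<2n)) ,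
    trans (sym (bitAt-‖-upper c d 0<2n)) (trans (cong (λ v → bitAt v (2n + 0)) eq) (bitAt-‖-upper c′ d′ 0<2n))

  constant-halves⇒‖ : ∀ {y} → (∀ t → t < 2n → bitAt y t ≡ bitAt y 0) →
                      (∀ s → s < 2n → bitAt y (2n + s) ≡ bitAt y (2n + 0)) → y ≡ bitAt y 0 ‖ bitAt y (2n + 0)
  constant-halves⇒‖ {y} lower upper = bitAt-ext-halves {2n} {2n}
    (λ t t<2n → trans (lower t t<2n) (sym (bitAt-‖-lower _ _ t<2n)))
    (λ s s<2n → trans (upper s s<2n) (sym (bitAt-‖-upper _ _ s<2n)))

  ≡‖⇒≡‖-bitAt : ∀ {x c d} → x ≡ c ‖ d → x ≡ bitAt x 0 ‖ bitAt x (2n + 0)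
  ≡‖⇒≡‖-bitAt {c = c} {d} refl = cong₂ _‖_ (sym (bitAt-‖-lower c d 0<2n)) (sym (bitAt-‖-upper c d 0<2n))

  act-a-‖ : ∀ c d → act (π a) (c ‖ d) ≡ c ‖ d
  act-a-‖ c d = act-a-fixed λ t t<L → halves t (split-< 2n t<L)
    where
    halves : ∀ t → t < 2n ⊎ Σ ℕ (λ s → s < 2n × t ≡ 2n + s) → bitAt (c ‖ d) (cycA n t) ≡ bitAt (c ‖ d) t
    halves t (inj₁ t<2n) = trans (bitAt-‖-lower c d (cycA-lower-half n 0<n t<2n)) (sym (bitAt-‖-lower c d t<2n))
    halves t (inj₂ (s , s<2n , refl)) with cycA-upper-half n 0<n s<2n
    ... | s′ , s′<2n , cycA≡ =
      trans (cong (bitAt (c ‖ d)) cycA≡) (trans (bitAt-‖-upper c d s′<2n) (sym (bitAt-‖-upper c d s<2n)))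

  a²≡a⊕act-a : a^ 2 ≡ a ⊕ act (π a) a
  a²≡a⊕act-a = cong (λ v → a ⊕ act (π a) v) (pow-1 a)

  a²≡𝟎⇒a²ᵏ≡𝟎 : a^ 2 ≡ 𝟎 → ∀ k → a^ (2 * k) ≡ 𝟎
  a²≡𝟎⇒a²ᵏ≡𝟎 a²≡𝟎 zero    = refl
  a²≡𝟎⇒a²ᵏ≡𝟎 a²≡𝟎 (suc k) = begin
    a^ (2 * suc k)     ≡⟨ cong a^ (ℕ.*-distribˡ-+ 2 1 k) ⟩
    a^ (2 + 2 * k)     ≡⟨ pow-+ 2 (2 * k) a∈C ⟩
    a^ 2 · a^ (2 * k)  ≡⟨ cong₂ _·_ a²≡𝟎 (a²≡𝟎⇒a²ᵏ≡𝟎 a²≡𝟎 k) ⟩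
    𝟎 · 𝟎              ≡⟨ ·-identityˡ 𝟎 ⟩
    𝟎                  ∎

  module PowerOfA {b a⁻ b⁻ : Word L} (π𝟏≗id : ∀ i → π 𝟏 ⟨$⟩ʳ i ≡ i)
                  (fixed-point-free : ∀ x → C x → x ≢ 𝟎 → x ≢ 𝟏 → ∀ i → π x ⟨$⟩ʳ i ≢ i)
                  (b∈C : C b) (a⁻∈C : C a⁻) (b⁻∈C : C b⁻) (a²ⁿ≡b² : a^ 2n ≡ pow π b 2)
                  (aa⁻≡𝟎 : a · a⁻ ≡ 𝟎) (bb⁻≡𝟎 : b · b⁻ ≡ 𝟎) (b⁻ab≡a⁻ : (b⁻ · a) · b ≡ a⁻)
                  (generated : ∀ x → C x → Gen π a b x)
                  (πb≗revB : ∀ i → toℕ (π b ⟨$⟩ʳ i) ≡ revB n (toℕ i)) where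

    a²ⁿ≡𝟎⊎a²ⁿ≡𝟏 : a^ 2n ≡ 𝟎 ⊎ a^ 2n ≡ 𝟏
    a²ⁿ≡𝟎⊎a²ⁿ≡𝟏 with ≡-dec _≟ᴮ_ (a^ 2n) 𝟎 | ≡-dec _≟ᴮ_ (a^ 2n) 𝟏
    ... | yes a²ⁿ≡𝟎 | _         = inj₁ a²ⁿ≡𝟎
    ... | no  _     | yes a²ⁿ≡𝟏 = inj₂ a²ⁿ≡𝟏
    ... | no  a²ⁿ≢𝟎 | no  a²ⁿ≢𝟏 = ⊥-elim (fixed-point-free (a^ 2n) (pow-closed 2n a∈C) a²ⁿ≢𝟎 a²ⁿ≢𝟏 Fin.zero
                                    (toℕ-injective (trans (toℕ-π-a^ 2n Fin.zero) (iterate-cycA-period n))))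

    -- If a²ⁿ = 𝟎, the relations make {aⁱ, aⁱ b : i < 2n} closed under right multiplication by a
    -- and b, hence equal to C; but 𝟏 ∈ C is none of these words, since π fixes the coordinate 0
    -- only for a⁰ = 𝟎, and π (aⁱ b) sends it into the upper half.
    module WhenA²ⁿ≡𝟎 (a²ⁿ≡𝟎 : a^ 2n ≡ 𝟎) where

      a^2n-1·a≡𝟎 : a^ 2n-1 · a ≡ 𝟎
      a^2n-1·a≡𝟎 = trans (sym (pow-sucʳ 2n-1 a∈C)) a²ⁿ≡𝟎

      a^-reduce : ∀ j → a^ (j + 2n) ≡ a^ j
      a^-reduce j = trans (pow-+ j 2n a∈C) (trans (cong (a^ j ·_) a²ⁿ≡𝟎) (·-identityʳ (a^ j)))

      a⁻≡a^2n-1 : a⁻ ≡ a^ 2n-1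
      a⁻≡a^2n-1 = begin
        a⁻                  ≡⟨ ·-identityˡ a⁻ ⟨
        𝟎 · a⁻              ≡⟨ cong (_· a⁻) a^2n-1·a≡𝟎 ⟨
        (a^ 2n-1 · a) · a⁻  ≡⟨ ·-assoc (pow-closed 2n-1 a∈C) a∈C a⁻ ⟩
        a^ 2n-1 · (a · a⁻)  ≡⟨ cong (a^ 2n-1 ·_) aa⁻≡𝟎 ⟩
        a^ 2n-1 · 𝟎         ≡⟨ ·-identityʳ (a^ 2n-1) ⟩
        a^ 2n-1             ∎

      ab≡ba^2n-1 : a · b ≡ b · a^ 2n-1
      ab≡ba^2n-1 = begin
        a · b               ≡⟨ cong (_· b) (·-identityˡ a) ⟨
        (𝟎 · a) · b         ≡⟨ cong (λ v → (v · a) · b) bb⁻≡𝟎 ⟨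
        ((b · b⁻) · a) · b  ≡⟨ cong (_· b) (·-assoc b∈C b⁻∈C a) ⟩
        (b · (b⁻ · a)) · b  ≡⟨ ·-assoc b∈C (·-closed b⁻∈C a∈C) b ⟩
        b · ((b⁻ · a) · b)  ≡⟨ cong (b ·_) (trans b⁻ab≡a⁻ a⁻≡a^2n-1) ⟩
        b · a^ 2n-1         ∎

      aba≡b : a · (b · a) ≡ b
      aba≡b = begin
        a · (b · a)        ≡⟨ ·-assoc a∈C b∈C a ⟨
        (a · b) · a        ≡⟨ cong (_· a) ab≡ba^2n-1 ⟩
        (b · a^ 2n-1) · a  ≡⟨ ·-assoc b∈C (pow-closed 2n-1 a∈C) a ⟩
        b · (a^ 2n-1 · a)  ≡⟨ cong (b ·_) a^2n-1·a≡𝟎 ⟩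
        b · 𝟎              ≡⟨ ·-identityʳ b ⟩
        b                  ∎

      ba≡a^2n-1b : b · a ≡ a^ 2n-1 · b
      ba≡a^2n-1b = begin
        b · a                    ≡⟨ ·-identityˡ (b · a) ⟨
        𝟎 · (b · a)              ≡⟨ cong (_· (b · a)) a^2n-1·a≡𝟎 ⟨
        (a^ 2n-1 · a) · (b · a)  ≡⟨ ·-assoc (pow-closed 2n-1 a∈C) a∈C (b · a) ⟩
        a^ 2n-1 · (a · (b · a))  ≡⟨ cong (a^ 2n-1 ·_) aba≡b ⟩
        a^ 2n-1 · b              ∎

      NormalForm : Word L → Set
      NormalForm x = (Σ ℕ λ i → i < 2n × x ≡ a^ i) ⊎ (Σ ℕ λ i → i < 2n × x ≡ a^ i · b)

      normalForm : ∀ {x} → Gen π a b x → NormalForm x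
      normalForm gen-0 = inj₁ (0 , 0<2n , refl)
      normalForm (gen-a g) with normalForm g
      ... | inj₁ (i , i<2n , refl) with ℕ.m≤n⇒m<n∨m≡n i<2n
      ...   | inj₁ i+1<2n = inj₁ (suc i , i+1<2n , sym (pow-sucʳ i a∈C))
      ...   | inj₂ i+1≡2n = inj₁ (0 , 0<2n , trans (sym (pow-sucʳ i a∈C)) (trans (cong a^ i+1≡2n) a²ⁿ≡𝟎))
      normalForm (gen-a g) | inj₂ (zero , _ , refl) =
        inj₂ (2n-1 , ℕ.≤-refl , trans (cong (_· a) (·-identityˡ b)) ba≡a^2n-1b)
      normalForm (gen-a g) | inj₂ (suc j , j+1<2n , refl) = inj₂ (j , ℕ.<-trans (ℕ.n<1+n j) j+1<2n , (begin
        (a^ (suc j) · b) · a        ≡⟨ ·-assoc (pow-closed (suc j) a∈C) b∈C a ⟩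
        a^ (suc j) · (b · a)        ≡⟨ cong (a^ (suc j) ·_) ba≡a^2n-1b ⟩
        a^ (suc j) · (a^ 2n-1 · b)  ≡⟨ ·-assoc (pow-closed (suc j) a∈C) (pow-closed 2n-1 a∈C) b ⟨
        (a^ (suc j) · a^ 2n-1) · b  ≡⟨ cong (_· b) (pow-+ (suc j) 2n-1 a∈C) ⟨
        a^ (suc j + 2n-1) · b       ≡⟨ cong (λ k → a^ k · b) (ℕ.+-suc j 2n-1) ⟨
        a^ (j + 2n) · b             ≡⟨ cong (_· b) (a^-reduce j) ⟩
        a^ j · b                    ∎))
      normalForm (gen-b g) with normalForm g
      ... | inj₁ (i , i<2n , refl) = inj₂ (i , i<2n , refl)
      ... | inj₂ (i , i<2n , refl) = inj₁ (i , i<2n , (begin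
        (a^ i · b) · b    ≡⟨ ·-assoc (pow-closed i a∈C) b∈C b ⟩
        a^ i · (b · b)    ≡⟨ cong (λ v → a^ i · (b · v)) (·-identityʳ b) ⟨
        a^ i · pow π b 2  ≡⟨ cong (a^ i ·_) a²ⁿ≡b² ⟨
        a^ i · a^ 2n      ≡⟨ pow-+ i 2n a∈C ⟨
        a^ (i + 2n)       ≡⟨ a^-reduce i ⟩
        a^ i              ∎))

      toℕ-π𝟏-zero : ∀ {x} → 𝟏 ≡ x → toℕ (π x ⟨$⟩ʳ Fin.zero) ≡ 0
      toℕ-π𝟏-zero refl = cong toℕ (π𝟏≗id Fin.zero)

      𝟏-has-no-normalForm : NormalForm 𝟏 → ⊥
      𝟏-has-no-normalForm (inj₁ (i , i<2n , 𝟏≡a^i)) = 𝟏≢𝟎 (trans 𝟏≡a^i (cong a^ i≡0))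
        where
        i≡0 : i ≡ 0
        i≡0 = trans (sym (iterate-cycA-lower n i<2n)) (trans (sym (toℕ-π-a^ i Fin.zero)) (toℕ-π𝟏-zero 𝟏≡a^i))
      𝟏-has-no-normalForm (inj₂ (i , i<2n , 𝟏≡a^ib)) = ℕ.<-irrefl refl (ℕ.<-≤-trans 0<2n (subst (2n ≤_) π-zero 2n≤π))
        where
        2n≤π : 2n ≤ iterate (cycA n) i (toℕ (π b ⟨$⟩ʳ Fin.zero))
        2n≤π = iterate-cycA-preserves-upper n i (subst (2n ≤_) (sym (πb≗revB Fin.zero)) (2*suc≤revB-0 m))
        π-zero : iterate (cycA n) i (toℕ (π b ⟨$⟩ʳ Fin.zero)) ≡ 0
        π-zero =
          trans (sym (toℕ-π-a^ i _)) (trans (cong toℕ (π-· (pow-closed i a∈C) b∈C Fin.zero)) (toℕ-π𝟏-zero 𝟏≡a^ib))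

    a²ⁿ≡𝟏 : a^ 2n ≡ 𝟏
    a²ⁿ≡𝟏 with a²ⁿ≡𝟎⊎a²ⁿ≡𝟏
    ... | inj₁ a²ⁿ≡𝟎 = ⊥-elim (WhenA²ⁿ≡𝟎.𝟏-has-no-normalForm a²ⁿ≡𝟎 (WhenA²ⁿ≡𝟎.normalForm a²ⁿ≡𝟎 (generated 𝟏 𝟏∈C)))
    ... | inj₂ a²ⁿ≡𝟏 = a²ⁿ≡𝟏

  bitAt-a² : ∀ k → bitAt (a^ 2) k ≡ bitAt a k xor bitAt (act (π a) a) k
  bitAt-a² k = trans (cong (λ v → bitAt v k) a²≡a⊕act-a) (bitAt-⊕ a (act (π a) a) k)

  bitAt-a²-shift : ∀ {o t} → HalfStart o → suc t < 2n →
                   bitAt (a^ 2) (o + suc t) ≡ bitAt a (o + suc t) xor bitAt a (o + t)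
  bitAt-a²-shift {o} {t} half t+1<2n =
    trans (bitAt-a² (o + suc t)) (cong (bitAt a (o + suc t) xor_) (bitAt-act-a-shift half t+1<2n a))

  xor<-a² : xor< 2n (bitAt (a^ 2)) ≡ false
  xor<-a² = begin
    xor< 2n (bitAt (a^ 2))                                    ≡⟨ rotate (bitAt (a^ 2)) ⟨
    xor< 2n (λ t → bitAt (a^ 2) (cycA n t))                   ≡⟨ xor<-cong 2n a²-cycA ⟩
    xor< 2n (λ t → bitAt a (cycA n t) xor bitAt a t)          ≡⟨ xor<-xor 2n (λ t → bitAt a (cycA n t)) (bitAt a) ⟩
    xor< 2n (λ t → bitAt a (cycA n t)) xor xor< 2n (bitAt a)  ≡⟨ cong (_xor xor< 2n (bitAt a)) (rotate (bitAt a)) ⟩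
    xor< 2n (bitAt a) xor xor< 2n (bitAt a)                   ≡⟨ xor-same (xor< 2n (bitAt a)) ⟩
    false                                                     ∎
    where
    rotate : ∀ f → xor< 2n (λ t → f (cycA n t)) ≡ xor< 2n f
    rotate f = xor<-rotate 2n-1 f (cycA n) (λ t t<M → cycA-lower n (s≤s t<M)) (cycA-lower-wrap n refl)
    a²-cycA : ∀ t → t < 2n → bitAt (a^ 2) (cycA n t) ≡ bitAt a (cycA n t) xor bitAt a t
    a²-cycA t t<2n =
      trans (bitAt-a² (cycA n t)) (cong (bitAt a (cycA n t) xor_) (bitAt-act (π a) {cycA n} πa≗cycA a (<2n⇒<L t<2n)))

  bitAt-a^-xor< : ∀ j → suc j ≤ 2n → bitAt (a^ (suc j)) j ≡ xor< (suc j) (bitAt a)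
  bitAt-a^-xor< zero    _        = cong (λ v → bitAt v 0) (pow-1 a)
  bitAt-a^-xor< (suc j) j+2≤2n = begin
    bitAt (a ⊕ act (π a) (a^ (suc j))) (suc j)
      ≡⟨ bitAt-⊕ a _ (suc j) ⟩
    bitAt a (suc j) xor bitAt (act (π a) (a^ (suc j))) (suc j)
      ≡⟨ cong (bitAt a (suc j) xor_) (bitAt-act-a-shift lower j+2≤2n (a^ (suc j))) ⟩
    bitAt a (suc j) xor bitAt (a^ (suc j)) j
      ≡⟨ cong (bitAt a (suc j) xor_) (bitAt-a^-xor< j (ℕ.<⇒≤ j+2≤2n)) ⟩
    bitAt a (suc j) xor xor< (suc j) (bitAt a)
      ≡⟨ xor-comm (bitAt a (suc j)) _ ⟩
    xor< (suc (suc j)) (bitAt a)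
      ∎

  module TwoDimensionalKernel {a⁻ : Word L} (π𝟏≗id : ∀ i → π 𝟏 ⟨$⟩ʳ i ≡ i) (a⁻∈C : C a⁻)
                              (aa⁻≡𝟎 : a · a⁻ ≡ 𝟎) (a²ⁿ≡𝟏 : a^ 2n ≡ 𝟏) (dim2 : KernelDim2 C) where

    open KernelOfDimension2 dim2

    𝟏∈K : Kernel C 𝟏
    𝟏∈K = Kernel-𝟏 complement-closed

    a≢‖ : ∀ c d → a ≢ c ‖ d
    a≢‖ c d refl = 𝟏≢𝟎 (trans (sym a²ⁿ≡𝟏) (a²≡𝟎⇒a²ᵏ≡𝟎 a²≡𝟎 n))
      where
      a²≡𝟎 : a^ 2 ≡ 𝟎
      a²≡𝟎 = trans a²≡a⊕act-a (trans (cong (a ⊕_) (act-a-‖ c d)) (⊕-self a))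

    act-a-kernel : ∀ {κ} → Kernel C κ → κ ≢ 𝟎 → κ ≢ 𝟏 → act (π a) κ ≡ κ ⊎ act (π a) κ ≡ κ ⊕ 𝟏
    act-a-kernel {κ} κ∈K κ≢𝟎 κ≢𝟏
      with Kernel-third κ∈K 𝟏∈K (Kernel-act a∈C a⁻∈C aa⁻≡𝟎 κ∈K) κ≢𝟎 𝟏≢𝟎 (κ≢𝟎 ∘ act-a≡replicate) κ≢𝟏
    ... | inj₁ fixed          = inj₁ fixed
    ... | inj₂ (inj₁ πκ≡𝟏)   = ⊥-elim (κ≢𝟏 (act-a≡replicate πκ≡𝟏))
    ... | inj₂ (inj₂ flipped) = inj₂ flipped

    fixed-half-constant : ∀ {x o} → act (π a) x ≡ x → HalfStart o → ∀ t → t < 2n → bitAt x (o + t) ≡ bitAt x (o + 0)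
    fixed-half-constant {x} {o} fixed half = stepwise-constant 2n (λ t → bitAt x (o + t)) λ t t+1<2n →
      trans (cong (λ v → bitAt v (o + suc t)) (sym fixed)) (bitAt-act-a-shift half t+1<2n x)

    flipped-half-alternating : ∀ {x o} → act (π a) x ≡ x ⊕ 𝟏 → HalfStart o →
                               ∀ t → t < 2n → bitAt x (o + t) ≡ odd t xor bitAt x (o + 0)
    flipped-half-alternating {x} {o} flipped half = stepwise-alternating 2n (λ t → bitAt x (o + t)) λ t t+1<2n →
      trans (sym (not-involutive _)) (cong not (flip t t+1<2n))
      where
      flip : ∀ t → suc t < 2n → not (bitAt x (o + suc t)) ≡ bitAt x (o + t)
      flip t t+1<2n = begin
        not (bitAt x (o + suc t))
          ≡⟨ xor-comm true (bitAt x (o + suc t)) ⟩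
        bitAt x (o + suc t) xor true
          ≡⟨ cong (bitAt x (o + suc t) xor_) (bitAt-replicate {L} true (halfStart+<L half t+1<2n)) ⟨
        bitAt x (o + suc t) xor bitAt (𝟏 {L}) (o + suc t)
          ≡⟨ bitAt-⊕ x 𝟏 (o + suc t) ⟨
        bitAt (x ⊕ 𝟏) (o + suc t)
          ≡⟨ cong (λ v → bitAt v (o + suc t)) flipped ⟨
        bitAt (act (π a) x) (o + suc t)
          ≡⟨ bitAt-act-a-shift half t+1<2n x ⟩
        bitAt x (o + t)
          ∎

    module HalvesInKernel (𝟎‖𝟏∈K : Kernel C (false ‖ true)) where

      ‖∈K : ∀ c d → Kernel C (c ‖ d)
      ‖∈K false false = subst (Kernel C) (sym (‖-same false)) Kernel-𝟎
      ‖∈K false true  = 𝟎‖𝟏∈K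
      ‖∈K true  false =
        subst (Kernel C) (trans (sym (map-not≡⊕𝟏 (false ‖ true))) (map-not-‖ false true)) (Kernel-⊕ 𝟎‖𝟏∈K 𝟏∈K)
      ‖∈K true  true  = subst (Kernel C) (sym (‖-same true)) 𝟏∈K

      ‖∈C : ∀ c d → C (c ‖ d)
      ‖∈C c d = Kernel⊆ 𝟎∈C (‖∈K c d)

      Balanced : Word L → ℕ → Set
      Balanced x o = signSum 2n (λ t → bitAt x (o + t)) ≡ + 0

      correlation-‖ : ∀ x c d → correlation x (c ‖ d) ≡
                      signSum 2n (λ t → bitAt x t xor c) +ℤ signSum 2n (λ s → bitAt x (2n + s) xor d)
      correlation-‖ x c d = trans (correlation≡signSum x (c ‖ d)) (trans (sumℤ<-+ 2n 2n _) (cong₂ _+ℤ_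
        (sumℤ<-cong 2n λ t t<2n → cong sgn (trans (bitAt-⊕ x (c ‖ d) t) (cong (bitAt x t xor_) (bitAt-‖-lower c d t<2n))))
        (sumℤ<-cong 2n λ s s<2n → cong sgn (trans (bitAt-⊕ x (c ‖ d) (2n + s))
                                                  (cong (bitAt x (2n + s) xor_) (bitAt-‖-upper c d s<2n))))))

      -- Orthogonality to false ‖ false and to false ‖ true gives S₀ + S₁ = 0 and S₀ − S₁ = 0
      -- for the sign sums S₀, S₁ of the two halves.
      balanced-halves : ∀ {x} → C x → (∀ c d → x ≢ c ‖ d) → ∀ {o} → HalfStart o → Balanced x o
      balanced-halves {x} x∈C x≢‖ = λ { (inj₁ refl) → S₀≡0 ; (inj₂ refl) → trans (sym S₀≡S₁) S₀≡0 }
        where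
        S₀ S₁ : ℤ
        S₀ = signSum 2n (bitAt x)
        S₁ = signSum 2n (λ s → bitAt x (2n + s))
        ⊥‖ : ∀ c d → correlation x (c ‖ d) ≡ + 0
        ⊥‖ c d = orthogonal x∈C (‖∈C c d) (x≢‖ c d) (λ x≡¬c‖d → x≢‖ (not c) (not d) (trans x≡¬c‖d (map-not-‖ c d)))
        xor-false : ∀ o → signSum 2n (λ t → bitAt x (o + t) xor false) ≡ signSum 2n (λ t → bitAt x (o + t))
        xor-false o = sumℤ<-cong 2n λ t _ → cong sgn (xor-identityʳ (bitAt x (o + t)))
        xor-true : ∀ o → signSum 2n (λ t → bitAt x (o + t) xor true) ≡ -ℤ signSum 2n (λ t → bitAt x (o + t))
        xor-true o =
          trans (sumℤ<-cong 2n λ t _ → cong sgn (xor-comm (bitAt x (o + t)) true)) (signSum-not 2n (λ t → bitAt x (o + t)))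
        S₀+S₁≡0 : S₀ +ℤ S₁ ≡ + 0
        S₀+S₁≡0 =
          trans (sym (cong₂ _+ℤ_ (xor-false 0) (xor-false 2n))) (trans (sym (correlation-‖ x false false)) (⊥‖ false false))
        S₀-S₁≡0 : S₀ +ℤ -ℤ S₁ ≡ + 0
        S₀-S₁≡0 =
          trans (sym (cong₂ _+ℤ_ (xor-false 0) (xor-true 2n))) (trans (sym (correlation-‖ x false true)) (⊥‖ false true))
        S₀≡S₁ : S₀ ≡ S₁
        S₀≡S₁ = ℤ.i-j≡0⇒i≡j S₀ S₁ S₀-S₁≡0
        S₀≡0 : S₀ ≡ + 0
        S₀≡0 = +ℤ-self≡0 S₀ (trans (cong (S₀ +ℤ_) S₀≡S₁) S₀+S₁≡0)

      a-balanced : ∀ {o} → HalfStart o → Balanced a o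
      a-balanced = balanced-halves a∈C a≢‖

      xor<-a : xor< 2n (bitAt a) ≡ true
      xor<-a = begin
        xor< 2n (bitAt a)   ≡⟨ bitAt-a^-xor< 2n-1 ℕ.≤-refl ⟨
        bitAt (a^ 2n) 2n-1  ≡⟨ cong (λ v → bitAt v 2n-1) a²ⁿ≡𝟏 ⟩
        bitAt (𝟏 {L}) 2n-1  ≡⟨ bitAt-replicate true (<2n⇒<L ℕ.≤-refl) ⟩
        true                ∎

      n-odd : odd n ≡ true
      n-odd = trans (sym (balanced⇒xor<≡odd-half n (bitAt a) (a-balanced lower))) xor<-a

      half-of-a²-nonzero : ∀ {o} → HalfStart o → (∀ t → suc t < 2n → bitAt (a^ 2) (o + suc t) ≡ false) → ⊥
      half-of-a²-nonzero {o} half a²-zero = ℕ.<-irrefl (sym 2n≡0) 0<2n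
        where
        constant : ∀ t → t < 2n → bitAt a (o + t) ≡ bitAt a (o + 0)
        constant = stepwise-constant 2n (λ t → bitAt a (o + t)) λ t t+1<2n →
          xor≡false⇒≡ (trans (sym (bitAt-a²-shift half t+1<2n)) (a²-zero t t+1<2n))
        2n≡0 : 2n ≡ 0
        2n≡0 = balanced-const⇒empty 2n (λ t → bitAt a (o + t)) _ (a-balanced half) constant

      module Large (2<2n : 2 < 2n) where

        a²≢‖ : ∀ c d → a^ 2 ≢ c ‖ d
        a²≢‖ false d    a²≡ = half-of-a²-nonzero lower λ t t+1<2n →
          trans (cong (λ v → bitAt v (suc t)) a²≡) (bitAt-‖-lower false d t+1<2n)
        a²≢‖ true false a²≡ = half-of-a²-nonzero upper λ t t+1<2n →
          trans (cong (λ v → bitAt v (2n + suc t)) a²≡) (bitAt-‖-upper true false t+1<2n)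
        a²≢‖ true true  a²≡ = ℕ.1+n≢0 (begin
          2                             ≡⟨ iterate-cycA-lower n 2<2n ⟨
          iterate (cycA n) 2 0          ≡⟨ toℕ-π-a^ 2 Fin.zero ⟨
          toℕ (π (a^ 2) ⟨$⟩ʳ Fin.zero)  ≡⟨ cong (λ v → toℕ (π v ⟨$⟩ʳ Fin.zero)) (trans a²≡ (‖-same true)) ⟩
          toℕ (π 𝟏 ⟨$⟩ʳ Fin.zero)       ≡⟨ cong toℕ (π𝟏≗id Fin.zero) ⟩
          0                             ∎)

        contradiction : ⊥
        contradiction = true≢false (begin
          true                    ≡⟨ n-odd ⟨
          odd n                   ≡⟨ balanced⇒xor<≡odd-half n (bitAt (a^ 2)) a²-balanced ⟨
          xor< 2n (bitAt (a^ 2))  ≡⟨ xor<-a² ⟩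
          false                   ∎)
          where
          a²-balanced : Balanced (a^ 2) 0
          a²-balanced = balanced-halves (pow-closed 2 a∈C) a²≢‖ lower

      module Small (2n≡2 : 2n ≡ 2) where

        <2n⇒≡0⊎≡1 : ∀ {t} → t < 2n → t ≡ 0 ⊎ t ≡ 1
        <2n⇒≡0⊎≡1 {zero}        _ = inj₁ refl
        <2n⇒≡0⊎≡1 {suc zero}    _ = inj₂ refl
        <2n⇒≡0⊎≡1 {suc (suc t)} t+2<2n with subst (suc (suc t) <_) 2n≡2 t+2<2n
        ... | s≤s (s≤s ())

        balanced-flips : ∀ x o → Balanced x o → bitAt x (o + 1) ≡ not (bitAt x (o + 0))
        balanced-flips x o balanced with bitAt x (o + 1) ≟ᴮ bitAt x (o + 0)
        ... | no  differ = ¬-not differ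
        ... | yes same   = ⊥-elim (ℕ.<-irrefl (sym (balanced-const⇒empty 2n _ _ balanced constant)) 0<2n)
          where
          constant : ∀ t → t < 2n → bitAt x (o + t) ≡ bitAt x (o + 0)
          constant t t<2n with <2n⇒≡0⊎≡1 t<2n
          ... | inj₁ refl = refl
          ... | inj₂ refl = same

        ⊕-constant-half : ∀ x y o → Balanced x o → Balanced y o →
                          ∀ t → t < 2n → bitAt (x ⊕ y) (o + t) ≡ bitAt (x ⊕ y) (o + 0)
        ⊕-constant-half x y o x-balanced y-balanced t t<2n with <2n⇒≡0⊎≡1 t<2n
        ... | inj₁ refl = refl
        ... | inj₂ refl = begin
          bitAt (x ⊕ y) (o + 1)
            ≡⟨ bitAt-⊕ x y (o + 1) ⟩
          bitAt x (o + 1) xor bitAt y (o + 1)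
            ≡⟨ cong₂ _xor_ (balanced-flips x o x-balanced) (balanced-flips y o y-balanced) ⟩
          not (bitAt x (o + 0)) xor not (bitAt y (o + 0))
            ≡⟨ xor-annihilates-not (bitAt x (o + 0)) (bitAt y (o + 0)) ⟩
          bitAt x (o + 0) xor bitAt y (o + 0)
            ≡⟨ bitAt-⊕ x y (o + 0) ⟨
          bitAt (x ⊕ y) (o + 0)
            ∎

        -- For length 4 the sum of two words balanced on both halves has constant halves,
        -- so C is closed under adding a.
        ⊕a∈C : ∀ {x} → C x → C (x ⊕ a)
        ⊕a∈C {x} x∈C with ≡-dec _≟ᴮ_ x (bitAt x 0 ‖ bitAt x (2n + 0))
        ... | yes x≡‖ = subst C (⊕-comm a x) (proj₁ (subst (Kernel C) (sym x≡‖) (‖∈K _ _) a) a∈C)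
        ... | no  x≢‖ = subst C (sym (constant-halves⇒‖ (⊕-constant-half x a 0 (x-balanced lower) (a-balanced lower))
                                                        (⊕-constant-half x a 2n (x-balanced upper) (a-balanced upper))))
                                (‖∈C _ _)
          where
          x-balanced : ∀ {o} → HalfStart o → Balanced x o
          x-balanced = balanced-halves x∈C λ c d x≡c‖d → x≢‖ (≡‖⇒≡‖-bitAt x≡c‖d)

        contradiction : ⊥
        contradiction with Kernel-third 𝟏∈K 𝟎‖𝟏∈K (Kernel-intro ⊕a∈C) 𝟏≢𝟎 𝟎‖𝟏≢𝟎 a≢𝟎 𝟏≢𝟎‖𝟏
          where
          𝟎‖𝟏≢𝟎 : false ‖ true ≢ 𝟎
          𝟎‖𝟏≢𝟎 eq = true≢false (proj₂ (‖-injective (trans eq (sym (‖-same false)))))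
          𝟏≢𝟎‖𝟏 : 𝟏 ≢ false ‖ true
          𝟏≢𝟎‖𝟏 eq = true≢false (proj₁ (‖-injective (trans (‖-same true) eq)))
          a≢𝟎 : a ≢ 𝟎
          a≢𝟎 eq = a≢‖ false false (trans eq (sym (‖-same false)))
        ... | inj₁ a≡𝟏          = a≢‖ true true (trans a≡𝟏 (sym (‖-same true)))
        ... | inj₂ (inj₁ a≡𝟎‖𝟏)  = a≢‖ false true a≡𝟎‖𝟏
        ... | inj₂ (inj₂ a≡𝟏⊕𝟎‖𝟏) = a≢‖ true false (trans a≡𝟏⊕𝟎‖𝟏 (trans (⊕-comm 𝟏 _)
                                      (trans (sym (map-not≡⊕𝟏 (false ‖ true))) (map-not-‖ false true))))

    𝟎‖𝟏∉K : Kernel C (false ‖ true) → ⊥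
    𝟎‖𝟏∉K 𝟎‖𝟏∈K with 2*suc≡2⊎2<2*suc m
    ... | inj₁ 2n≡2 = HalvesInKernel.Small.contradiction 𝟎‖𝟏∈K 2n≡2
    ... | inj₂ 2<2n = HalvesInKernel.Large.contradiction 𝟎‖𝟏∈K 2<2n

    act-a-kernel-not-fixed : ∀ {κ} → Kernel C κ → κ ≢ 𝟎 → bitAt κ 0 ≡ false → act (π a) κ ≢ κ
    act-a-kernel-not-fixed {κ} κ∈K κ≢𝟎 κ₀≡false fixed = upper-cases (bitAt κ (2n + 0)) κ≡false‖
      where
      κ≡false‖ : κ ≡ false ‖ bitAt κ (2n + 0)
      κ≡false‖ = trans (constant-halves⇒‖ (fixed-half-constant fixed lower) (fixed-half-constant fixed upper))
                       (cong (_‖ bitAt κ (2n + 0)) κ₀≡false)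
      upper-cases : ∀ c → κ ≡ false ‖ c → ⊥
      upper-cases false κ≡ = κ≢𝟎 (trans κ≡ (‖-same false))
      upper-cases true  κ≡ = 𝟎‖𝟏∉K (subst (Kernel C) κ≡ κ∈K)

    act-a-flipped⇒vAlt : ∀ {κ} → act (π a) κ ≡ κ ⊕ 𝟏 → bitAt κ 0 ≡ false →
                          κ ≡ vAlt n ++ vAlt n ⊎ κ ≡ vAlt n ++ map not (vAlt n)
    act-a-flipped⇒vAlt {κ} flipped κ₀≡false = upper-cases (bitAt κ (2n + 0)) refl
      where
      κ-lower : ∀ w t → t < 2n → bitAt κ t ≡ bitAt (vAlt n ++ w) t
      κ-lower w t t<2n = begin
        bitAt κ t              ≡⟨ flipped-half-alternating flipped lower t t<2n ⟩
        odd t xor bitAt κ 0    ≡⟨ cong (odd t xor_) κ₀≡false ⟩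
        odd t xor false        ≡⟨ xor-identityʳ (odd t) ⟩
        odd t                  ≡⟨ bitAt-vAlt n t<2n ⟨
        bitAt (vAlt n) t       ≡⟨ bitAt-++ˡ (vAlt n) w t<2n ⟨
        bitAt (vAlt n ++ w) t  ∎
      κ-upper : ∀ s → s < 2n → bitAt κ (2n + s) ≡ odd s xor bitAt κ (2n + 0)
      κ-upper = flipped-half-alternating flipped upper
      upper-cases : ∀ c → bitAt κ (2n + 0) ≡ c → κ ≡ vAlt n ++ vAlt n ⊎ κ ≡ vAlt n ++ map not (vAlt n)
      upper-cases false κ₂ₙ≡false = inj₁ (bitAt-ext-halves {2n} {2n} (κ-lower (vAlt n)) λ s s<2n → begin
        bitAt κ (2n + s)                   ≡⟨ κ-upper s s<2n ⟩
        odd s xor bitAt κ (2n + 0)         ≡⟨ cong (odd s xor_) κ₂ₙ≡false ⟩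
        odd s xor false                    ≡⟨ xor-identityʳ (odd s) ⟩
        odd s                              ≡⟨ bitAt-vAlt n s<2n ⟨
        bitAt (vAlt n) s                   ≡⟨ bitAt-++ʳ (vAlt n) (vAlt n) s<2n ⟨
        bitAt (vAlt n ++ vAlt n) (2n + s)  ∎)
      upper-cases true  κ₂ₙ≡true = inj₂ (bitAt-ext-halves {2n} {2n} (κ-lower (map not (vAlt n))) λ s s<2n → begin
        bitAt κ (2n + s)                             ≡⟨ κ-upper s s<2n ⟩
        odd s xor bitAt κ (2n + 0)                   ≡⟨ cong (odd s xor_) κ₂ₙ≡true ⟩
        odd s xor true                               ≡⟨ xor-comm (odd s) true ⟩
        not (odd s)                                  ≡⟨ cong not (bitAt-vAlt n s<2n) ⟨
        not (bitAt (vAlt n) s)                       ≡⟨ bitAt-map not (vAlt n) s<2n ⟨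
        bitAt (map not (vAlt n)) s                   ≡⟨ bitAt-++ʳ (vAlt n) (map not (vAlt n)) s<2n ⟨
        bitAt (vAlt n ++ map not (vAlt n)) (2n + s)  ∎)

    kernel-word-shape : ∀ κ → Kernel C κ → κ ≢ 𝟎 → κ ≢ 𝟏 → (∀ i → toℕ i ≡ zero → lookup κ i ≡ false) →
                        κ ≡ vAlt n ++ vAlt n ⊎ κ ≡ vAlt n ++ map not (vAlt n)
    kernel-word-shape κ κ∈K κ≢𝟎 κ≢𝟏 κ₀≡false with act-a-kernel κ∈K κ≢𝟎 κ≢𝟏
    ... | inj₁ fixed   =
        ⊥-elim (act-a-kernel-not-fixed κ∈K κ≢𝟎 (trans (bitAt-toℕ κ Fin.zero) (κ₀≡false Fin.zero refl)) fixed)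
    ... | inj₂ flipped = act-a-flipped⇒vAlt flipped (trans (bitAt-toℕ κ Fin.zero) (κ₀≡false Fin.zero refl))

    normalised-kernel-word : Σ (Word L) λ κ → Kernel C κ × κ ≢ 𝟎 × κ ≢ 𝟏 × (∀ i → toℕ i ≡ zero → lookup κ i ≡ false)
    normalised-kernel-word with ∃-Kernel-≢𝟎-≢𝟏
    ... | κ , κ∈K , κ≢𝟎 , κ≢𝟏 with lookup κ Fin.zero in κ₀
    ... | false = κ , κ∈K , κ≢𝟎 , κ≢𝟏 , λ i i≡0 → trans (cong (lookup κ) (toℕ-injective i≡0)) κ₀
    ... | true  = κ ⊕ 𝟏 , Kernel-⊕ κ∈K 𝟏∈K ,
                  (λ κ⊕𝟏≡𝟎 → κ≢𝟏 (trans (sym (⊕-cancelʳ κ 𝟏)) (trans (cong (_⊕ 𝟏) κ⊕𝟏≡𝟎) (⊕-identityˡ 𝟏)))) ,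
                  (λ κ⊕𝟏≡𝟏 → κ≢𝟎 (trans (sym (⊕-cancelʳ κ 𝟏)) (trans (cong (_⊕ 𝟏) κ⊕𝟏≡𝟏) (⊕-self 𝟏)))) ,
                  λ i i≡0 → trans (cong (lookup (κ ⊕ 𝟏)) (toℕ-injective i≡0))
                                  (trans (lookup-⊕ κ 𝟏 Fin.zero) (cong (_xor lookup (𝟏 {L}) Fin.zero) κ₀))

proposition10 : (n : ℕ) (C : Word (len n) → Set) (π : Word (len n) → Permutation′ (len n))
    (a b : Word (len n)) →
    IsHFP (len n) C π → IsTypeQ n C π a b →
    (∀ i → toℕ (π a ⟨$⟩ʳ i) ≡ cycA n (toℕ i)) →
    (∀ i → toℕ (π b ⟨$⟩ʳ i) ≡ revB n (toℕ i)) →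
    KernelDim2 C →
    (Σ (Word (len n)) λ κ → Kernel C κ × κ ≢ 𝟎 × κ ≢ 𝟏 × (∀ i → toℕ i ≡ zero → lookup κ i ≡ false))
    × (∀ κ → Kernel C κ → κ ≢ 𝟎 → κ ≢ 𝟏 → (∀ i → toℕ i ≡ zero → lookup κ i ≡ false) →
         κ ≡ vAlt n ++ vAlt n ⊎ κ ≡ vAlt n ++ map not (vAlt n))
proposition10 zero _ _ _ _ _ _ _ _ dim2 = ⊥-elim (proj₁ (proj₂ (proj₂ dim2)) (empty (proj₁ dim2)))
  where
  empty : (v : Word 0) → v ≡ 𝟎
  empty [] = refl
proposition10 (suc m) C π a b (propelinear , hadamard , π𝟎≗id , π𝟏≗id , fixed-point-free)
  (a∈C , b∈C , _ , a²ⁿ≡b² , (a⁻ , b⁻ , a⁻∈C , b⁻∈C , aa⁻≡𝟎 , bb⁻≡𝟎 , b⁻ab≡a⁻) , generated) πa≗cycA πb≗revB dim2 =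
  normalised-kernel-word , kernel-word-shape
  where
  open TypeQ m {C} {π} {a} propelinear hadamard π𝟎≗id a∈C πa≗cycA
  open PowerOfA π𝟏≗id fixed-point-free b∈C a⁻∈C b⁻∈C a²ⁿ≡b² aa⁻≡𝟎 bb⁻≡𝟎 b⁻ab≡a⁻ generated πb≗revB
  open TwoDimensionalKernel π𝟏≗id a⁻∈C aa⁻≡𝟎 a²ⁿ≡𝟏 dim2
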